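{- For $n\ge0$ let $v_1(n)$ be the number of permutations of $[n]$ containing exactly one occurrence of the pattern $1\text{ - }32$, and let $B_n$ be the $n$th Bell number. Then $v_1(0)=0$ and, for every $n\ge 0$, $$v_1(n+1)=v_1(n)+\sum_{k=1}^{n-1}\left[\binom{n}{k}v_1(k)+\binom{n-1}{k-1}B_k\right].$$
   Context: An occurrence of the pattern $1\text{ - }32$ in a permutation $\pi=a_1a_2\cdots a_n$ of $[n]$ is a pair of indices $(i,j)$ with $1\le i<j<n$ such that $a_i<a_{j+1}<a_j$ (the last two letters adjacent in $\pi$). $B_n$ denotes the $n$th Bell number ($B_0=1,B_1=1,B_2=2,B_3=5,\dots$). -}

module Defs where

open import Data.Nat using (ℕ; zero; suc; _+_; _*_; _∸_; _<ᵇ_)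
open import Data.Nat.Combinatorics using (_C_)
open import Data.Bool using (Bool; true; false; _∧_; if_then_else_)
open import Data.List using (List; []; _∷_; _++_; map; concatMap; length; filter; upTo)
open import Data.Nat.ListAction using (sum)
open import Relation.Binary.PropositionalEquality using (_≡_)
open import Data.Nat using (_≟_)

insertions : ℕ → List ℕ → List (List ℕ)
insertions x [] = (x ∷ []) ∷ []
insertions x (y ∷ ys) = (x ∷ y ∷ ys) ∷ map (y ∷_) (insertions x ys)

perms : ℕ → List (List ℕ)
perms zero = [] ∷ []
perms (suc n) = concatMap (insertions (suc n)) (perms n)

-- number of occurrences of 1-32:
-- pairs i<j with j+1 ≤ n such that a_i < a_{j+1} < a_j
-- occWith a w : for the letter a (playing the role of a_i), count adjacent pairs
-- (a_j, a_{j+1}) in w (strictly after a_i) with a < a_{j+1} < a_j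
occWith : ℕ → List ℕ → ℕ
occWith a [] = 0
occWith a (x ∷ []) = 0
occWith a (x ∷ y ∷ ys) =
  (if (a <ᵇ y) ∧ (y <ᵇ x) then 1 else 0) + occWith a (y ∷ ys)

occ132 : List ℕ → ℕ
occ132 [] = 0
occ132 (a ∷ w) = occWith a w + occ132 w

v1 : ℕ → ℕ
v1 n = length (filter (λ p → occ132 p ≟ 1) (perms n))

stirling2 : ℕ → ℕ → ℕ
stirling2 zero zero = 1
stirling2 zero (suc k) = 0
stirling2 (suc n) zero = 0
stirling2 (suc n) (suc k) = suc k * stirling2 n (suc k) + stirling2 n k

bell : ℕ → ℕ
bell n = sum (map (stirling2 n) (upTo (suc n)))

-- Σ_{k=a}^{b} f k  (empty when b < a)
sumFromTo : ℕ → ℕ → (ℕ → ℕ) → ℕ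
sumFromTo a b f = sum (map (λ i → f (a + i)) (upTo (suc b ∸ a)))

-- Every permutation of [n + 1] arises exactly once by inserting n + 1 into a permutation of [n].
-- Inserting the new largest letter right after a descent, or at the end, creates no occurrence of
-- 1-32 and keeps the number of descents; inserting it at the front adds a descent and no
-- occurrence; inserting it right after an ascent a_j < a_{j+1} adds a descent and one occurrence
-- for each letter among a_1 … a_j that is smaller than a_{j+1}. Recorded by the number d of
-- descents, this turns four counts into linear recurrences in (n, d): the avoiders (which are
-- counted by S(n, d + 1)), the avoiders that start with a descent, the avoiders weighted by their
-- ascents creating a single occurrence, and the permutations with exactly one occurrence. The last
-- three arrays X then satisfy X(n + 1, d + 1) = Σ_j C(n, j) X(j, d) + W(n, d) with W equal to 0, to
-- S(n, d + 2) and to (d + 1) S(n, d + 2) respectively. Summing the last identity over d, and using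
-- Σ_i C(m, i) S(i + 1, d + 1) = (d + 1) S(m + 1, d + 2) + S(m + 1, d + 1), gives
-- v₁(m + 2) + B_{m+1} = Σ_j C(m + 1, j) v₁(j) + Σ_i C(m, i) B_{i+1}, which is the recurrence.

module Submission where

open import Defs
open import Data.Bool using (Bool; true; false; not; T; _∧_; if_then_else_)
open import Data.List using (List; []; _∷_; _++_; map; concatMap; length; filter; applyUpTo)
open import Data.Nat.ListAction using (sum)
open import Data.List.Relation.Unary.All as All using (All; []; _∷_)
open import Data.List.Relation.Unary.All.Properties using (map⁺; concat⁺)
open import Data.Nat
open import Data.Nat.Combinatorics using (_C_; nCn≡1; nCk+nC[k+1]≡[n+1]C[k+1]; k>n⇒nCk≡0)
open import Data.Nat.Properties
open import Data.Nat.Tactic.RingSolver using (solve-∀)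
open import Algebra.Properties.CommutativeSemigroup +-commutativeSemigroup using (interchange; xy∙z≈xz∙y)
open import Data.Empty using (⊥-elim)
open import Function using (_∘_)
open import Data.Unit using (⊤; tt)
open import Data.Product using (_×_; _,_)
open import Relation.Binary.PropositionalEquality
open import Relation.Binary.Definitions using (tri<; tri≈; tri>)
open import Relation.Nullary using (¬_)

𝟙 : Bool → ℕ
𝟙 true  = 1
𝟙 false = 0

δ : ℕ → ℕ → ℕ
δ m n = 𝟙 (m ≡ᵇ n)

δ-refl : ∀ m → δ m m ≡ 1
δ-refl zero    = refl
δ-refl (suc m) = δ-refl m

δ-≢ : ∀ {m n} → m ≢ n → δ m n ≡ 0
δ-≢ {m} {n} m≢n with m ≡ᵇ n in eq
... | false = refl
... | true  = ⊥-elim (m≢n (≡ᵇ⇒≡ m n (subst T (sym eq) _)))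

δ-+ˡ : ∀ k m n → δ (k + m) (k + n) ≡ δ m n
δ-+ˡ zero    m n = refl
δ-+ˡ (suc k) m n = δ-+ˡ k m n

δ-+ʳ : ∀ k m n → δ (m + k) (n + k) ≡ δ m n
δ-+ʳ k m n rewrite +-comm m k | +-comm n k = δ-+ˡ k m n

δ-≢-* : ∀ {m n} → m ≢ n → ∀ k → δ m n * k ≡ 0
δ-≢-* m≢n k = cong (_* k) (δ-≢ m≢n)

*-δ-≢ : ∀ k {m n} → m ≢ n → k * δ m n ≡ 0
*-δ-≢ k m≢n = trans (cong (k *_) (δ-≢ m≢n)) (*-zeroʳ k)

*-δ-refl : ∀ k m → k * δ m m ≡ k
*-δ-refl k m = trans (cong (k *_) (δ-refl m)) (*-identityʳ k)

δ-weight : ∀ m n (f : ℕ → ℕ) → δ m n * f m ≡ δ m n * f n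
δ-weight m n f with m ≡ᵇ n in eq
... | true  rewrite ≡ᵇ⇒≡ m n (subst T (sym eq) _) = refl
... | false = refl

<⇒<ᵇ≡true : ∀ {m n} → m < n → (m <ᵇ n) ≡ true
<⇒<ᵇ≡true {m} {n} m<n with m <ᵇ n | <⇒<ᵇ m<n
... | true | _ = refl

≮⇒<ᵇ≡false : ∀ {m n} → ¬ m < n → (m <ᵇ n) ≡ false
≮⇒<ᵇ≡false {m} {n} m≮n with m <ᵇ n in eq
... | false = refl
... | true  = ⊥-elim (m≮n (<ᵇ⇒< m n (subst T (sym eq) _)))

<ᵇ-flip : ∀ {u y} → u ≢ y → (y <ᵇ u) ≡ not (u <ᵇ y)
<ᵇ-flip {u} {y} u≢y with <-cmp u y
... | tri< u<y _ _ rewrite <⇒<ᵇ≡true u<y | ≮⇒<ᵇ≡false (<⇒≯ u<y) = refl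
... | tri≈ _ u≡y _ = ⊥-elim (u≢y u≡y)
... | tri> _ _ y<u rewrite <⇒<ᵇ≡true y<u | ≮⇒<ᵇ≡false (<⇒≯ y<u) = refl

𝟙-∧ : ∀ b b′ → 𝟙 b′ * 𝟙 b ≡ (if b ∧ b′ then 1 else 0)
𝟙-∧ false b′     = *-zeroʳ (𝟙 b′)
𝟙-∧ true  false  = refl
𝟙-∧ true  true   = refl

sumOver : {A : Set} → List A → (A → ℕ) → ℕ
sumOver []       f = 0
sumOver (a ∷ as) f = f a + sumOver as f

module _ {A : Set} where

  sumOver-cong : ∀ (as : List A) {f g : A → ℕ} → (∀ a → f a ≡ g a) → sumOver as f ≡ sumOver as g
  sumOver-cong []       f≗g = refl
  sumOver-cong (a ∷ as) f≗g = cong₂ _+_ (f≗g a) (sumOver-cong as f≗g)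

  sumOver-congᴬ : ∀ {P : A → Set} {as : List A} {f g : A → ℕ} →
                  All P as → (∀ {a} → P a → f a ≡ g a) → sumOver as f ≡ sumOver as g
  sumOver-congᴬ []         f≗g = refl
  sumOver-congᴬ (pa ∷ pas) f≗g = cong₂ _+_ (f≗g pa) (sumOver-congᴬ pas f≗g)

  sumOver-vanishing : ∀ (as : List A) {f : A → ℕ} → (∀ a → f a ≡ 0) → sumOver as f ≡ 0
  sumOver-vanishing []       f≗0 = refl
  sumOver-vanishing (a ∷ as) f≗0 rewrite f≗0 a = sumOver-vanishing as f≗0

  sumOver-+ : ∀ (as : List A) (f g : A → ℕ) → sumOver as (λ a → f a + g a) ≡ sumOver as f + sumOver as g
  sumOver-+ []       f g = refl
  sumOver-+ (a ∷ as) f g rewrite sumOver-+ as f g = interchange (f a) (g a) (sumOver as f) (sumOver as g)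

  sumOver-*ˡ : ∀ (as : List A) k (f : A → ℕ) → sumOver as (λ a → k * f a) ≡ k * sumOver as f
  sumOver-*ˡ []       k f = sym (*-zeroʳ k)
  sumOver-*ˡ (a ∷ as) k f rewrite sumOver-*ˡ as k f = sym (*-distribˡ-+ k (f a) (sumOver as f))

  sumOver-++ : ∀ (as bs : List A) (f : A → ℕ) → sumOver (as ++ bs) f ≡ sumOver as f + sumOver bs f
  sumOver-++ []       bs f = refl
  sumOver-++ (a ∷ as) bs f rewrite sumOver-++ as bs f = sym (+-assoc (f a) _ _)

  sumOver-map : ∀ {B : Set} (h : B → A) (bs : List B) (f : A → ℕ) → sumOver (map h bs) f ≡ sumOver bs (λ b → f (h b))
  sumOver-map h []       f = refl
  sumOver-map h (b ∷ bs) f = cong (f (h b) +_) (sumOver-map h bs f)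

  sumOver-concatMap : ∀ {B : Set} (h : B → List A) (bs : List B) (f : A → ℕ) →
                      sumOver (concatMap h bs) f ≡ sumOver bs (λ b → sumOver (h b) f)
  sumOver-concatMap h []       f = refl
  sumOver-concatMap h (b ∷ bs) f =
    trans (sumOver-++ (h b) (concatMap h bs) f) (cong (sumOver (h b) f +_) (sumOver-concatMap h bs f))

sumBelow : ℕ → (ℕ → ℕ) → ℕ
sumBelow zero    f = 0
sumBelow (suc D) f = f 0 + sumBelow D (λ d → f (suc d))

sumBelow-cong : ∀ D {f g : ℕ → ℕ} → (∀ d → d < D → f d ≡ g d) → sumBelow D f ≡ sumBelow D g
sumBelow-cong zero    f≗g = refl
sumBelow-cong (suc D) f≗g = cong₂ _+_ (f≗g 0 z<s) (sumBelow-cong D (λ d d<D → f≗g (suc d) (s<s d<D)))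

sumBelow-+ : ∀ D (f g : ℕ → ℕ) → sumBelow D (λ d → f d + g d) ≡ sumBelow D f + sumBelow D g
sumBelow-+ zero    f g = refl
sumBelow-+ (suc D) f g rewrite sumBelow-+ D (λ d → f (suc d)) (λ d → g (suc d)) =
  interchange (f 0) (g 0) (sumBelow D (λ d → f (suc d))) (sumBelow D (λ d → g (suc d)))

sumBelow-*ˡ : ∀ D k (f : ℕ → ℕ) → sumBelow D (λ d → k * f d) ≡ k * sumBelow D f
sumBelow-*ˡ zero    k f = sym (*-zeroʳ k)
sumBelow-*ˡ (suc D) k f rewrite sumBelow-*ˡ D k (λ d → f (suc d)) = sym (*-distribˡ-+ k (f 0) _)

sumBelow-vanishing : ∀ D {f : ℕ → ℕ} → (∀ d → f d ≡ 0) → sumBelow D f ≡ 0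
sumBelow-vanishing zero    f≗0 = refl
sumBelow-vanishing (suc D) f≗0 rewrite f≗0 0 = sumBelow-vanishing D (λ d → f≗0 (suc d))

sumBelow-δ : ∀ {n D} → n < D → sumBelow D (δ n) ≡ 1
sumBelow-δ {zero}  {suc D} _         = cong suc (sumBelow-vanishing D {λ d → δ 0 (suc d)} (λ _ → refl))
sumBelow-δ {suc n} {suc D} (s<s n<D) = sumBelow-δ n<D

sumBelow-last : ∀ D (f : ℕ → ℕ) → sumBelow (suc D) f ≡ sumBelow D f + f D
sumBelow-last zero    f = +-identityʳ (f 0)
sumBelow-last (suc D) f rewrite sumBelow-last D (λ d → f (suc d)) = sym (+-assoc (f 0) _ _)

sumBelow-truncate : ∀ {n D} (f : ℕ → ℕ) → n ≤ D → (∀ d → n ≤ d → f d ≡ 0) → sumBelow D f ≡ sumBelow n f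
sumBelow-truncate {zero}  {D}     f _         f≗0 = sumBelow-vanishing D (λ d → f≗0 d z≤n)
sumBelow-truncate {suc n} {suc D} f (s≤s n≤D) f≗0 =
  cong (f 0 +_) (sumBelow-truncate (λ d → f (suc d)) n≤D (λ d n≤d → f≗0 (suc d) (s≤s n≤d)))

sumBelow-swap : ∀ D E (f : ℕ → ℕ → ℕ) →
                sumBelow D (λ d → sumBelow E (λ e → f e d)) ≡ sumBelow E (λ e → sumBelow D (f e))
sumBelow-swap D zero    f = sumBelow-vanishing D (λ _ → refl)
sumBelow-swap D (suc E) f =
  trans (sumBelow-+ D (f 0) (λ d → sumBelow E (λ e → f (suc e) d)))
        (cong (sumBelow D (f 0) +_) (sumBelow-swap D E (λ e → f (suc e))))

sumOver-sumBelow : ∀ {A : Set} (as : List A) D (f : A → ℕ → ℕ) →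
                   sumOver as (λ a → sumBelow D (f a)) ≡ sumBelow D (λ d → sumOver as (λ a → f a d))
sumOver-sumBelow []       D f = sym (sumBelow-vanishing D (λ _ → refl))
sumOver-sumBelow (a ∷ as) D f rewrite sumOver-sumBelow as D f = sym (sumBelow-+ D (f a) _)

sum-map-applyUpTo : ∀ n (f g : ℕ → ℕ) → sum (map f (applyUpTo g n)) ≡ sumBelow n (λ i → f (g i))
sum-map-applyUpTo zero    f g = refl
sum-map-applyUpTo (suc n) f g = cong (f (g 0) +_) (sum-map-applyUpTo n f (λ i → g (suc i)))

binomialSum : ℕ → (ℕ → ℕ) → ℕ
binomialSum n f = sumBelow (suc n) (λ k → (n C k) * f k)

binomialSum-pascal : ∀ n (f : ℕ → ℕ) → binomialSum (suc n) f ≡ binomialSum n f + binomialSum n (λ j → f (suc j))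
binomialSum-pascal n f = begin
  1 * f 0 + sumBelow (suc n) (λ k → (suc n C suc k) * f (suc k))
    ≡⟨ cong (1 * f 0 +_) (sumBelow-cong (suc n) (λ k _ → pascal k)) ⟩
  1 * f 0 + sumBelow (suc n) (λ k → (n C suc k) * f (suc k) + (n C k) * f (suc k))
    ≡⟨ cong (1 * f 0 +_) (sumBelow-+ (suc n) (λ k → (n C suc k) * f (suc k)) (λ k → (n C k) * f (suc k))) ⟩
  1 * f 0 + (sumBelow (suc n) (λ k → (n C suc k) * f (suc k)) + binomialSum n (λ j → f (suc j)))
    ≡⟨ sym (+-assoc (1 * f 0) _ _) ⟩
  1 * f 0 + sumBelow (suc n) (λ k → (n C suc k) * f (suc k)) + binomialSum n (λ j → f (suc j))
    ≡⟨ cong (_+ binomialSum n (λ j → f (suc j))) (sumBelow-truncate (λ k → (n C k) * f k) (n≤1+n (suc n)) beyond) ⟩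
  binomialSum n f + binomialSum n (λ j → f (suc j)) ∎
  where
  open ≡-Reasoning
  pascal : ∀ k → (suc n C suc k) * f (suc k) ≡ (n C suc k) * f (suc k) + (n C k) * f (suc k)
  pascal k = trans (cong (_* f (suc k)) (sym (trans (+-comm (n C suc k) (n C k)) (nCk+nC[k+1]≡[n+1]C[k+1] n k))))
                   (*-distribʳ-+ (f (suc k)) (n C suc k) (n C k))
  beyond : ∀ k → suc n ≤ k → (n C k) * f k ≡ 0
  beyond k n<k = cong (_* f k) (k>n⇒nCk≡0 n<k)

binomialSum-cong : ∀ n {f g : ℕ → ℕ} → (∀ j → j ≤ n → f j ≡ g j) → binomialSum n f ≡ binomialSum n g
binomialSum-cong n f≗g = sumBelow-cong (suc n) (λ { j (s≤s j≤n) → cong ((n C j) *_) (f≗g j j≤n) })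

binomialSum-+ : ∀ n (f g : ℕ → ℕ) → binomialSum n (λ j → f j + g j) ≡ binomialSum n f + binomialSum n g
binomialSum-+ n f g =
  trans (sumBelow-cong (suc n) (λ j _ → *-distribˡ-+ (n C j) (f j) (g j)))
        (sumBelow-+ (suc n) (λ j → (n C j) * f j) (λ j → (n C j) * g j))

binomialSum-*ˡ : ∀ n k (f : ℕ → ℕ) → binomialSum n (λ j → k * f j) ≡ k * binomialSum n f
binomialSum-*ˡ n k f =
  trans (sumBelow-cong (suc n) (λ j _ → x*[k*y]≡k*[x*y] (n C j) k (f j)))
        (sumBelow-*ˡ (suc n) k (λ j → (n C j) * f j))
  where
  x*[k*y]≡k*[x*y] : ∀ x k y → x * (k * y) ≡ k * (x * y)
  x*[k*y]≡k*[x*y] = solve-∀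

binomialSum-zero : ∀ n → binomialSum n (λ _ → 0) ≡ 0
binomialSum-zero n = sumBelow-vanishing (suc n) (λ j → *-zeroʳ (n C j))

sumBelow-binomialSum : ∀ D n (f : ℕ → ℕ → ℕ) →
                       sumBelow D (λ d → binomialSum n (λ j → f j d)) ≡ binomialSum n (λ j → sumBelow D (f j))
sumBelow-binomialSum D n f =
  trans (sumBelow-swap D (suc n) (λ j d → (n C j) * f j d))
        (sumBelow-cong (suc n) (λ j _ → sumBelow-*ˡ D (n C j) (f j)))

stirling2-above : ∀ {n k} → n < k → stirling2 n k ≡ 0
stirling2-above {zero}  {suc k} _         = refl
stirling2-above {suc n} {suc k} (s<s n<k)
  rewrite stirling2-above (m<n⇒m<1+n n<k) | stirling2-above n<k = trans (+-identityʳ _) (*-zeroʳ (suc k))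

binomialSum-stirling2 : ∀ n k → binomialSum n (λ j → stirling2 j k) ≡ stirling2 (suc n) (suc k)
binomialSum-stirling2 zero zero    = refl
binomialSum-stirling2 zero (suc k) = sym (cong (_+ 0) (*-zeroʳ (suc (suc k))))
binomialSum-stirling2 (suc n) zero = begin
  binomialSum (suc n) (λ j → stirling2 j 0)        ≡⟨ binomialSum-pascal n (λ j → stirling2 j 0) ⟩
  binomialSum n (λ j → stirling2 j 0) + binomialSum n (λ _ → 0)
    ≡⟨ cong₂ _+_ (binomialSum-stirling2 n 0) (binomialSum-zero n) ⟩
  stirling2 (suc n) 1 + 0                          ≡⟨ cong (_+ 0) (sym (+-identityʳ _)) ⟩
  stirling2 (suc (suc n)) 1                        ∎
  where open ≡-Reasoning
binomialSum-stirling2 (suc n) (suc k) = begin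
  binomialSum (suc n) (λ j → stirling2 j (suc k))
    ≡⟨ binomialSum-pascal n (λ j → stirling2 j (suc k)) ⟩
  binomialSum n (λ j → stirling2 j (suc k)) + binomialSum n (λ j → suc k * stirling2 j (suc k) + stirling2 j k)
    ≡⟨ cong (binomialSum n (λ j → stirling2 j (suc k)) +_)
            (trans (binomialSum-+ n (λ j → suc k * stirling2 j (suc k)) (λ j → stirling2 j k))
                   (cong (_+ binomialSum n (λ j → stirling2 j k)) (binomialSum-*ˡ n (suc k) (λ j → stirling2 j (suc k))))) ⟩
  Sₖ₊₁ + (suc k * Sₖ₊₁ + binomialSum n (λ j → stirling2 j k))
    ≡⟨ cong₂ (λ s t → s + (suc k * s + t)) (binomialSum-stirling2 n (suc k)) (binomialSum-stirling2 n k) ⟩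
  stirling2 (suc n) (suc (suc k)) + (suc k * stirling2 (suc n) (suc (suc k)) + stirling2 (suc n) (suc k))
    ≡⟨ sym (+-assoc (stirling2 (suc n) (suc (suc k))) _ _) ⟩
  stirling2 (suc (suc n)) (suc (suc k))          ∎
  where
  open ≡-Reasoning
  Sₖ₊₁ = binomialSum n (λ j → stirling2 j (suc k))

binomialSum-stirling2-suc : ∀ m d → binomialSum m (λ i → stirling2 (suc i) (suc d)) ≡
                                    suc d * stirling2 (suc m) (2 + d) + stirling2 (suc m) (suc d)
binomialSum-stirling2-suc m d =
  trans (binomialSum-+ m (λ i → suc d * stirling2 i (suc d)) (λ i → stirling2 i d))
        (cong₂ _+_ (trans (binomialSum-*ˡ m (suc d) (λ i → stirling2 i (suc d))) (cong (suc d *_) (binomialSum-stirling2 m (suc d))))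
                   (binomialSum-stirling2 m d))

bell-stirling2 : ∀ {m D} → suc m ≤ D → bell (suc m) ≡ sumBelow D (λ d → stirling2 (suc m) (suc d))
bell-stirling2 {m} {D} m<D =
  trans (sum-map-applyUpTo (2 + m) (stirling2 (suc m)) (λ i → i))
        (sym (sumBelow-truncate (λ d → stirling2 (suc m) (suc d)) m<D (λ d m<d → stirling2-above (s≤s m<d))))

-- Statistics of words

Counter : Set
Counter = ℕ → ℕ

push : ℕ → Counter → Counter
push u c v = c v + 𝟙 (u <ᵇ v)

fresh : Counter
fresh _ = 0

-- If c v is the number of letters preceding u that are smaller than v, then occ c u w counts the
-- occurrences of 1-32 whose letters 3 and 2 lie in u ∷ w: a descent onto v contributes one
-- occurrence for each earlier letter below v.
occ : Counter → ℕ → List ℕ → ℕ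
occ c u []      = 0
occ c u (v ∷ w) = 𝟙 (v <ᵇ u) * c v + occ (push u c) v w

descentsFrom : ℕ → List ℕ → ℕ
descentsFrom u []      = 0
descentsFrom u (v ∷ w) = 𝟙 (v <ᵇ u) + descentsFrom v w

-- Counts the ascents a < v of u ∷ w for which a is the only letter up to a that is smaller than v:
-- exactly the slots where inserting a new largest letter creates a single occurrence of 1-32.
singleSlotsFrom : Counter → ℕ → List ℕ → ℕ
singleSlotsFrom c u []      = 0
singleSlotsFrom c u (v ∷ w) = 𝟙 (u <ᵇ v) * δ (c v) 0 + singleSlotsFrom (push u c) v w

-- True when inserting a new largest letter right after u creates no occurrence (also when w = []).
descentAfter : ℕ → List ℕ → Bool
descentAfter u []      = true
descentAfter u (v ∷ w) = v <ᵇ u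

AdjacentDistinct : List ℕ → Set
AdjacentDistinct (u ∷ v ∷ w) = u ≢ v × AdjacentDistinct (v ∷ w)
AdjacentDistinct _           = ⊤

descents : List ℕ → ℕ
descents []      = 0
descents (u ∷ w) = descentsFrom u w

singleSlots : List ℕ → ℕ
singleSlots []      = 0
singleSlots (u ∷ w) = singleSlotsFrom fresh u w

startsDown : List ℕ → Bool
startsDown []      = false
startsDown (u ∷ w) = descentAfter u w

avoids once avoidsDown avoidsSlots : List ℕ → ℕ
avoids      p = δ (occ132 p) 0
once        p = δ (occ132 p) 1
avoidsDown  p = avoids p * 𝟙 (startsDown p)
avoidsSlots p = avoids p * singleSlots p

occ-cong : ∀ {c c′} u w → All (λ v → c v ≡ c′ v) w → occ c u w ≡ occ c′ u w
occ-cong u []      []          = refl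
occ-cong u (v ∷ w) (cv≡ ∷ c≗) =
  cong₂ _+_ (cong (𝟙 (v <ᵇ u) *_) cv≡) (occ-cong v w (All.map (cong (_+ _)) c≗))

singleSlotsFrom-cong : ∀ {c c′} u w → All (λ v → c v ≡ c′ v) w → singleSlotsFrom c u w ≡ singleSlotsFrom c′ u w
singleSlotsFrom-cong u []      []          = refl
singleSlotsFrom-cong u (v ∷ w) (cv≡ ∷ c≗) =
  cong₂ _+_ (cong (λ n → 𝟙 (u <ᵇ v) * δ n 0) cv≡) (singleSlotsFrom-cong v w (All.map (cong (_+ _)) c≗))

occ-push : ∀ c a u w → occ (push a c) u w ≡ occ c u w + occWith a (u ∷ w)
occ-push c a u []       = refl
occ-push c a u (v ∷ vs) = begin
  𝟙 (v <ᵇ u) * (c v + 𝟙 (a <ᵇ v)) + occ (push u (push a c)) v vs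
    ≡⟨ cong₂ _+_ (*-distribˡ-+ (𝟙 (v <ᵇ u)) (c v) (𝟙 (a <ᵇ v)))
                 (trans (occ-cong v vs (All.tabulate (λ {z} _ → push-comm z))) (occ-push (push u c) a v vs)) ⟩
  𝟙 (v <ᵇ u) * c v + 𝟙 (v <ᵇ u) * 𝟙 (a <ᵇ v) + (occ (push u c) v vs + occWith a (v ∷ vs))
    ≡⟨ interchange (𝟙 (v <ᵇ u) * c v) _ _ _ ⟩
  𝟙 (v <ᵇ u) * c v + occ (push u c) v vs + (𝟙 (v <ᵇ u) * 𝟙 (a <ᵇ v) + occWith a (v ∷ vs))
    ≡⟨ cong (λ t → 𝟙 (v <ᵇ u) * c v + occ (push u c) v vs + (t + occWith a (v ∷ vs))) (𝟙-∧ (a <ᵇ v) (v <ᵇ u)) ⟩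
  occ c u (v ∷ vs) + occWith a (u ∷ v ∷ vs) ∎
  where
  open ≡-Reasoning
  push-comm : ∀ z → push u (push a c) z ≡ push a (push u c) z
  push-comm z = xy∙z≈xz∙y (c z) (𝟙 (a <ᵇ z)) (𝟙 (u <ᵇ z))

occ132≡occ : ∀ u w → occ132 (u ∷ w) ≡ occ fresh u w
occ132≡occ u []       = refl
occ132≡occ u (v ∷ vs) = begin
  occWith u (v ∷ vs) + occ132 (v ∷ vs)                  ≡⟨ cong (occWith u (v ∷ vs) +_) (occ132≡occ v vs) ⟩
  occWith u (v ∷ vs) + occ fresh v vs                   ≡⟨ +-comm (occWith u (v ∷ vs)) _ ⟩
  occ fresh v vs + occWith u (v ∷ vs)                   ≡⟨ occ-push fresh u v vs ⟨
  occ (push u fresh) v vs                               ≡⟨ cong (_+ occ (push u fresh) v vs) (*-zeroʳ (𝟙 (v <ᵇ u))) ⟨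
  occ fresh u (v ∷ vs)                                  ∎
  where open ≡-Reasoning

-- Inserting a new largest letter

module InsertMax (x : ℕ) where

  push-max : ∀ c {w} → All (_< x) w → All (λ v → push x c v ≡ c v) w
  push-max c = All.map (λ {v} v<x → trans (cong (λ b → c v + 𝟙 b) (≮⇒<ᵇ≡false (<⇒≯ v<x))) (+-identityʳ (c v)))

  module _ {u : ℕ} (u<x : u < x) where

    private
      x<ᵇu : (x <ᵇ u) ≡ false
      x<ᵇu = ≮⇒<ᵇ≡false (<⇒≯ u<x)

    descentsFrom-atEnd : descentsFrom u (x ∷ []) ≡ 0
    descentsFrom-atEnd rewrite x<ᵇu = refl

    occ-atEnd : ∀ c → occ c u (x ∷ []) ≡ 0
    occ-atEnd c rewrite x<ᵇu = refl

    singleSlotsFrom-atEnd : ∀ c → singleSlotsFrom c u (x ∷ []) ≡ δ (c x) 0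
    singleSlotsFrom-atEnd c rewrite <⇒<ᵇ≡true u<x = trans (+-identityʳ _) (+-identityʳ _)

    module _ {y : ℕ} {ys : List ℕ} (y<x : y < x) (ys<x : All (_< x) ys) where

      private
        y<ᵇx : (y <ᵇ x) ≡ true
        y<ᵇx = <⇒<ᵇ≡true y<x

      descentsFrom-afterHead : descentsFrom u (x ∷ y ∷ ys) ≡ suc (descentsFrom y ys)
      descentsFrom-afterHead rewrite x<ᵇu | y<ᵇx = refl

      occ-afterHead : ∀ c → u ≢ y → occ c u (x ∷ y ∷ ys) ≡ 𝟙 (u <ᵇ y) * suc (c y) + occ c u (y ∷ ys)
      occ-afterHead c u≢y rewrite x<ᵇu | y<ᵇx | <ᵇ-flip u≢y =
        trans (cong₂ _+_ (+-identityʳ (push u c y)) (occ-cong y ys (push-max (push u c) ys<x)))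
              (split (u <ᵇ y) (c y) (occ (push u c) y ys))
        where
        split : ∀ b k r → k + 𝟙 b + r ≡ 𝟙 b * suc k + (𝟙 (not b) * k + r)
        split true  k r = trans (cong (_+ r) (+-comm k 1)) (cong (λ n → n + r) (sym (+-identityʳ (suc k))))
        split false k r = refl

      singleSlotsFrom-afterHead : ∀ c → singleSlotsFrom c u (x ∷ y ∷ ys) ≡ δ (c x) 0 + singleSlotsFrom (push u c) y ys
      singleSlotsFrom-afterHead c rewrite <⇒<ᵇ≡true u<x | ≮⇒<ᵇ≡false (<⇒≯ y<x) =
        cong₂ _+_ (+-identityʳ _) (singleSlotsFrom-cong y ys (push-max (push u c) ys<x))

  no-descent-onto-max : ∀ {u} → u < x → ∀ k → k * 𝟙 (x <ᵇ u) ≡ 0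
  no-descent-onto-max u<x k = trans (cong (λ b → k * 𝟙 b) (≮⇒<ᵇ≡false (<⇒≯ u<x))) (*-zeroʳ k)

  kept raisedByOne : Counter → ℕ → List ℕ → List ℕ → ℕ
  kept        c u w q = δ (occ c u q) (occ c u w)
  raisedByOne c u w q = δ (occ c u q) (suc (occ c u w))

  data Effect (c : Counter) (u : ℕ) (w q : List ℕ) : Set where
    keeps  : occ c u q ≡ occ c u w → descentsFrom u q ≡ descentsFrom u w → Effect c u w q
    raises : occ c u w < occ c u q → descentsFrom u q ≡ suc (descentsFrom u w) → Effect c u w q

  effects : ∀ c u w → u < x → All (_< x) w → AdjacentDistinct (u ∷ w) → All (Effect c u w) (insertions x w)
  effects c u []       u<x []           tt          = keeps (occ-atEnd u<x c) (descentsFrom-atEnd u<x) ∷ []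
  effects c u (y ∷ ys) u<x (y<x ∷ ys<x) (u≢y , adj) =
    afterHead ∷ map⁺ (All.map extend (effects (push u c) y ys y<x ys<x adj))
    where
    D′ = descentsFrom y ys
    afterHead : Effect c u (y ∷ ys) (x ∷ y ∷ ys)
    afterHead = classify (u <ᵇ y) (occ-afterHead u<x y<x ys<x c u≢y) (<ᵇ-flip u≢y)
      where
      classify : ∀ b → occ c u (x ∷ y ∷ ys) ≡ 𝟙 b * suc (c y) + occ c u (y ∷ ys) → (y <ᵇ u) ≡ not b →
                 Effect c u (y ∷ ys) (x ∷ y ∷ ys)
      classify true  occ≡ flip =
        raises (subst (occ c u (y ∷ ys) <_) (sym occ≡) (s≤s (m≤n+m _ (c y + 0))))
               (trans (descentsFrom-afterHead u<x y<x ys<x) (cong (λ b → suc (𝟙 b + D′)) (sym flip)))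
      classify false occ≡ flip =
        keeps occ≡ (trans (descentsFrom-afterHead u<x y<x ys<x) (cong (λ b → 𝟙 b + D′) (sym flip)))
    extend : ∀ {q} → Effect (push u c) y ys q → Effect c u (y ∷ ys) (y ∷ q)
    extend (keeps  occ≡ des≡) = keeps (cong (𝟙 (y <ᵇ u) * c y +_) occ≡) (cong (𝟙 (y <ᵇ u) +_) des≡)
    extend (raises occ< des≡) =
      raises (+-monoʳ-< (𝟙 (y <ᵇ u) * c y) occ<) (trans (cong (𝟙 (y <ᵇ u) +_) des≡) (+-suc (𝟙 (y <ᵇ u)) D′))

  module _ {c : Counter} {u y : ℕ} {ys : List ℕ} (u<x : u < x) (y<x : y < x) (ys<x : All (_< x) ys) (u≢y : u ≢ y) where

    private
      δ-gain₀ : ∀ b k → δ (𝟙 b * suc k) 0 ≡ 𝟙 (not b)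
      δ-gain₀ true  k = refl
      δ-gain₀ false k = refl

      δ-gain₁ : ∀ b k → δ (𝟙 b * suc k) 1 ≡ 𝟙 b * δ k 0
      δ-gain₁ true  k = trans (cong (λ n → δ n 0) (+-identityʳ k)) (sym (+-identityʳ (δ k 0)))
      δ-gain₁ false k = refl

    kept-afterHead : kept c u (y ∷ ys) (x ∷ y ∷ ys) ≡ 𝟙 (y <ᵇ u)
    kept-afterHead = begin
      δ (occ c u (x ∷ y ∷ ys)) O                ≡⟨ cong (λ o → δ o O) (occ-afterHead u<x y<x ys<x c u≢y) ⟩
      δ (𝟙 (u <ᵇ y) * suc (c y) + O) (0 + O)    ≡⟨ δ-+ʳ O (𝟙 (u <ᵇ y) * suc (c y)) 0 ⟩
      δ (𝟙 (u <ᵇ y) * suc (c y)) 0              ≡⟨ δ-gain₀ (u <ᵇ y) (c y) ⟩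
      𝟙 (not (u <ᵇ y))                          ≡⟨ cong 𝟙 (<ᵇ-flip u≢y) ⟨
      𝟙 (y <ᵇ u)                                ∎
      where
      open ≡-Reasoning
      O = occ c u (y ∷ ys)

    raisedByOne-afterHead : raisedByOne c u (y ∷ ys) (x ∷ y ∷ ys) ≡ 𝟙 (u <ᵇ y) * δ (c y) 0
    raisedByOne-afterHead = begin
      δ (occ c u (x ∷ y ∷ ys)) (suc O)          ≡⟨ cong (λ o → δ o (suc O)) (occ-afterHead u<x y<x ys<x c u≢y) ⟩
      δ (𝟙 (u <ᵇ y) * suc (c y) + O) (1 + O)    ≡⟨ δ-+ʳ O (𝟙 (u <ᵇ y) * suc (c y)) 1 ⟩
      δ (𝟙 (u <ᵇ y) * suc (c y)) 1              ≡⟨ δ-gain₁ (u <ᵇ y) (c y) ⟩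
      𝟙 (u <ᵇ y) * δ (c y) 0                    ∎
      where
      open ≡-Reasoning
      O = occ c u (y ∷ ys)

  kept-extend : ∀ c u y ys q → kept c u (y ∷ ys) (y ∷ q) ≡ kept (push u c) y ys q
  kept-extend c u y ys q = δ-+ˡ (𝟙 (y <ᵇ u) * c y) _ _

  raisedByOne-extend : ∀ c u y ys q → raisedByOne c u (y ∷ ys) (y ∷ q) ≡ raisedByOne (push u c) y ys q
  raisedByOne-extend c u y ys q =
    trans (cong (δ (K + occ (push u c) y q)) (sym (+-suc K _))) (δ-+ˡ K _ _)
    where K = 𝟙 (y <ᵇ u) * c y

  kept-count : ∀ c u w → u < x → All (_< x) w → AdjacentDistinct (u ∷ w) →
               sumOver (insertions x w) (kept c u w) ≡ suc (descentsFrom u w)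
  kept-count c u []       u<x []           tt          = cong (λ o → δ o 0 + 0) (occ-atEnd u<x c)
  kept-count c u (y ∷ ys) u<x (y<x ∷ ys<x) (u≢y , adj) = begin
    kept c u (y ∷ ys) (x ∷ y ∷ ys) + sumOver (map (y ∷_) (insertions x ys)) (kept c u (y ∷ ys))
      ≡⟨ cong₂ _+_ (kept-afterHead u<x y<x ys<x u≢y)
                   (trans (sumOver-map (y ∷_) (insertions x ys) (kept c u (y ∷ ys)))
                   (trans (sumOver-cong (insertions x ys) (kept-extend c u y ys))
                          (kept-count (push u c) y ys y<x ys<x adj))) ⟩
    𝟙 (y <ᵇ u) + suc (descentsFrom y ys)
      ≡⟨ +-suc (𝟙 (y <ᵇ u)) (descentsFrom y ys) ⟩
    suc (descentsFrom u (y ∷ ys)) ∎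
    where open ≡-Reasoning

  raisedByOne-count : ∀ c u w → u < x → All (_< x) w → AdjacentDistinct (u ∷ w) →
                      sumOver (insertions x w) (raisedByOne c u w) ≡ singleSlotsFrom c u w
  raisedByOne-count c u []       u<x []           tt          = cong (λ o → δ o 1 + 0) (occ-atEnd u<x c)
  raisedByOne-count c u (y ∷ ys) u<x (y<x ∷ ys<x) (u≢y , adj) =
    cong₂ _+_ (raisedByOne-afterHead u<x y<x ys<x u≢y)
              (trans (sumOver-map (y ∷_) (insertions x ys) (raisedByOne c u (y ∷ ys)))
              (trans (sumOver-cong (insertions x ys) (raisedByOne-extend c u y ys))
                     (raisedByOne-count (push u c) y ys y<x ys<x adj)))

  kept-descentAfter : ∀ c u w → u < x → All (_< x) w → AdjacentDistinct (u ∷ w) →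
                      sumOver (insertions x w) (λ q → kept c u w q * 𝟙 (descentAfter u q)) ≡
                      descentsFrom u w * 𝟙 (descentAfter u w)
  kept-descentAfter c u []       u<x []           tt          =
    trans (+-identityʳ _) (no-descent-onto-max u<x (kept c u [] (x ∷ [])))
  kept-descentAfter c u (y ∷ ys) u<x (y<x ∷ ys<x) (u≢y , adj) = begin
    kept c u w (x ∷ w) * 𝟙 (x <ᵇ u) + sumOver (map (y ∷_) (insertions x ys)) (λ q → kept c u w q * 𝟙 (descentAfter u q))
      ≡⟨ cong₂ _+_ (no-descent-onto-max u<x (kept c u w (x ∷ w))) (sumOver-map (y ∷_) (insertions x ys) _) ⟩
    sumOver (insertions x ys) (λ q → kept c u w (y ∷ q) * 𝟙 (y <ᵇ u))
      ≡⟨ sumOver-cong (insertions x ys) (λ q → trans (*-comm _ (𝟙 (y <ᵇ u))) (cong (𝟙 (y <ᵇ u) *_) (kept-extend c u y ys q))) ⟩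
    sumOver (insertions x ys) (λ q → 𝟙 (y <ᵇ u) * kept (push u c) y ys q)
      ≡⟨ sumOver-*ˡ (insertions x ys) (𝟙 (y <ᵇ u)) (kept (push u c) y ys) ⟩
    𝟙 (y <ᵇ u) * sumOver (insertions x ys) (kept (push u c) y ys)
      ≡⟨ cong (𝟙 (y <ᵇ u) *_) (kept-count (push u c) y ys y<x ys<x adj) ⟩
    𝟙 (y <ᵇ u) * suc (descentsFrom y ys)
      ≡⟨ idempotent (y <ᵇ u) (descentsFrom y ys) ⟩
    descentsFrom u w * 𝟙 (y <ᵇ u) ∎
    where
    open ≡-Reasoning
    w = y ∷ ys
    idempotent : ∀ b n → 𝟙 b * suc n ≡ (𝟙 b + n) * 𝟙 b
    idempotent true  n = trans (+-identityʳ (suc n)) (sym (*-identityʳ (suc n)))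
    idempotent false n = sym (*-zeroʳ n)

  kept-singleSlots : ∀ c u w → u < x → All (_< x) w → AdjacentDistinct (u ∷ w) →
                     sumOver (insertions x w) (λ q → kept c u w q * singleSlotsFrom c u q) ≡
                     suc (descentsFrom u w) * singleSlotsFrom c u w + 𝟙 (descentAfter u w) * δ (c x) 0
  kept-singleSlots c u []       u<x []           tt          =
    trans (cong₂ (λ o s → δ o 0 * s + 0) (occ-atEnd u<x c) (singleSlotsFrom-atEnd u<x c)) (+-identityʳ _)
  kept-singleSlots c u (y ∷ ys) u<x (y<x ∷ ys<x) (u≢y , adj) = begin
    kept c u w (x ∷ w) * singleSlotsFrom c u (x ∷ w) +
    sumOver (map (y ∷_) (insertions x ys)) (λ q → kept c u w q * singleSlotsFrom c u q)
      ≡⟨ cong₂ _+_ (cong₂ _*_ (kept-afterHead u<x y<x ys<x u≢y) (singleSlotsFrom-afterHead u<x y<x ys<x c)) extension ⟩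
    𝟙 (y <ᵇ u) * (δ (c x) 0 + S′) + (𝟙 (u <ᵇ y) * s * suc D′ + suc D′ * S′)
      ≡⟨ cong (λ b → 𝟙 b * (δ (c x) 0 + S′) + (𝟙 (u <ᵇ y) * s * suc D′ + suc D′ * S′)) (<ᵇ-flip u≢y) ⟩
    𝟙 (not (u <ᵇ y)) * (δ (c x) 0 + S′) + (𝟙 (u <ᵇ y) * s * suc D′ + suc D′ * S′)
      ≡⟨ rearrange (u <ᵇ y) s (δ (c x) 0) S′ D′ ⟩
    suc (𝟙 (not (u <ᵇ y)) + D′) * (𝟙 (u <ᵇ y) * s + S′) + 𝟙 (not (u <ᵇ y)) * δ (c x) 0
      ≡⟨ cong (λ b → suc (𝟙 b + D′) * (𝟙 (u <ᵇ y) * s + S′) + 𝟙 b * δ (c x) 0) (<ᵇ-flip u≢y) ⟨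
    suc (descentsFrom u w) * singleSlotsFrom c u w + 𝟙 (descentAfter u w) * δ (c x) 0 ∎
    where
    open ≡-Reasoning
    w  = y ∷ ys
    s  = δ (c y) 0
    D′ = descentsFrom y ys
    S′ = singleSlotsFrom (push u c) y ys
    K  = kept (push u c) y ys

    rearrange : ∀ b s X S D → 𝟙 (not b) * (X + S) + (𝟙 b * s * suc D + suc D * S) ≡
                              suc (𝟙 (not b) + D) * (𝟙 b * s + S) + 𝟙 (not b) * X
    rearrange true  = solve-∀
    rearrange false = solve-∀

    pushed-max : ∀ b → 𝟙 b * δ (push u c x) 0 ≡ 0
    pushed-max b = trans (cong (λ n → 𝟙 b * δ n 0) (trans (cong (λ b′ → c x + 𝟙 b′) (<⇒<ᵇ≡true u<x)) (+-comm (c x) 1)))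
                         (*-zeroʳ (𝟙 b))

    distribute : ∀ q → kept c u w (y ∷ q) * (𝟙 (u <ᵇ y) * s + singleSlotsFrom (push u c) y q) ≡
                       K q * (𝟙 (u <ᵇ y) * s) + K q * singleSlotsFrom (push u c) y q
    distribute q = trans (cong (_* (𝟙 (u <ᵇ y) * s + singleSlotsFrom (push u c) y q)) (kept-extend c u y ys q))
                         (*-distribˡ-+ (K q) (𝟙 (u <ᵇ y) * s) _)

    extension : sumOver (map (y ∷_) (insertions x ys)) (λ q → kept c u w q * singleSlotsFrom c u q) ≡
                𝟙 (u <ᵇ y) * s * suc D′ + suc D′ * S′
    extension = begin
      sumOver (map (y ∷_) (insertions x ys)) (λ q → kept c u w q * singleSlotsFrom c u q)
        ≡⟨ sumOver-map (y ∷_) (insertions x ys) _ ⟩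
      sumOver (insertions x ys) (λ q → kept c u w (y ∷ q) * (𝟙 (u <ᵇ y) * s + singleSlotsFrom (push u c) y q))
        ≡⟨ sumOver-cong (insertions x ys) distribute ⟩
      sumOver (insertions x ys) (λ q → K q * (𝟙 (u <ᵇ y) * s) + K q * singleSlotsFrom (push u c) y q)
        ≡⟨ sumOver-+ (insertions x ys) _ _ ⟩
      sumOver (insertions x ys) (λ q → K q * (𝟙 (u <ᵇ y) * s)) +
      sumOver (insertions x ys) (λ q → K q * singleSlotsFrom (push u c) y q)
        ≡⟨ cong₂ _+_ (trans (sumOver-cong (insertions x ys) (λ q → *-comm (K q) (𝟙 (u <ᵇ y) * s)))
                     (trans (sumOver-*ˡ (insertions x ys) (𝟙 (u <ᵇ y) * s) K)
                            (cong (𝟙 (u <ᵇ y) * s *_) (kept-count (push u c) y ys y<x ys<x adj))))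
                     (kept-singleSlots (push u c) y ys y<x ys<x adj) ⟩
      𝟙 (u <ᵇ y) * s * suc D′ + (suc D′ * S′ + 𝟙 (descentAfter y ys) * δ (push u c x) 0)
        ≡⟨ cong (λ z → 𝟙 (u <ᵇ y) * s * suc D′ + (suc D′ * S′ + z)) (pushed-max (descentAfter y ys)) ⟩
      𝟙 (u <ᵇ y) * s * suc D′ + (suc D′ * S′ + 0)
        ≡⟨ cong (𝟙 (u <ᵇ y) * s * suc D′ +_) (+-identityʳ (suc D′ * S′)) ⟩
      𝟙 (u <ᵇ y) * s * suc D′ + suc D′ * S′ ∎

  module _ {c : Counter} {u : ℕ} {w q : List ℕ} where

    kept-weight : Effect c u w q → (g : ℕ → ℕ) → kept c u w q * g (descentsFrom u q) ≡ kept c u w q * g (descentsFrom u w)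
    kept-weight (keeps  _    des≡) g = cong (λ d → kept c u w q * g d) des≡
    kept-weight (raises occ< _)    g = trans (δ-≢-* (>⇒≢ occ<) _) (sym (δ-≢-* (>⇒≢ occ<) _))

    raisedByOne-weight : Effect c u w q → (g : ℕ → ℕ) →
                         raisedByOne c u w q * g (descentsFrom u q) ≡ raisedByOne c u w q * g (suc (descentsFrom u w))
    raisedByOne-weight (keeps  occ≡ _)    g = trans (δ-≢-* occ≢ _) (sym (δ-≢-* occ≢ _))
      where occ≢ = λ eq → 1+n≢n (sym (trans (sym occ≡) eq))
    raisedByOne-weight (raises _    des≡) g = cong (λ d → raisedByOne c u w q * g d) des≡

    avoids-split : Effect c u w q → δ (occ c u q) 0 ≡ δ (occ c u w) 0 * kept c u w q
    avoids-split (keeps  occ≡ _) rewrite occ≡ = sym (*-δ-refl (δ (occ c u w) 0) (occ c u w))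
    avoids-split (raises occ< _) = trans (δ-≢ (m<n⇒n≢0 occ<)) (sym (*-δ-≢ (δ (occ c u w) 0) (>⇒≢ occ<)))

    once-split : Effect c u w q → δ (occ c u q) 1 ≡ δ (occ c u w) 1 * kept c u w q + δ (occ c u w) 0 * raisedByOne c u w q
    once-split (keeps  occ≡ _) rewrite occ≡ =
      sym (trans (cong₂ _+_ (*-δ-refl (δ (occ c u w) 1) (occ c u w)) (*-δ-≢ (δ (occ c u w) 0) {occ c u w} (1+n≢n ∘ sym)))
                 (+-identityʳ _))
    once-split (raises occ< _) =
      trans (one-above occ<) (sym (cong (_+ δ (occ c u w) 0 * raisedByOne c u w q) (*-δ-≢ (δ (occ c u w) 1) (>⇒≢ occ<))))
      where
      one-above : ∀ {o o′} → o < o′ → δ o′ 1 ≡ δ o 0 * δ o′ (suc o)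
      one-above {zero}                _         = sym (+-identityʳ _)
      one-above {suc o} {suc (suc _)} _         = refl
      one-above {suc o} {suc zero}    (s<s ())

module InsertMaxInto {x u w} (u<x : u < x) (w<x : All (_< x) w) (adj : AdjacentDistinct (u ∷ w)) where

  open InsertMax x

  private
    p = u ∷ w
    D = descentsFrom u w
    κ = kept fresh u w
    ρ = raisedByOne fresh u w
    effs = effects fresh u w u<x w<x adj

  occ132-front : occ132 (x ∷ p) ≡ occ132 p
  occ132-front =
    trans (occ132≡occ x p)
    (trans (cong₂ _+_ (*-zeroʳ (𝟙 (u <ᵇ x))) (occ-cong u w (push-max fresh w<x)))
           (sym (occ132≡occ u w)))

  descents-front : descents (x ∷ p) ≡ suc D
  descents-front = cong (λ b → 𝟙 b + D) (<⇒<ᵇ≡true u<x)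

  singleSlots-front : singleSlots (x ∷ p) ≡ singleSlots p
  singleSlots-front = cong₂ (λ b s → 𝟙 b * 1 + s) (≮⇒<ᵇ≡false (<⇒≯ u<x)) (singleSlotsFrom-cong u w (push-max fresh w<x))

  startsDown-front : startsDown (x ∷ p) ≡ true
  startsDown-front = <⇒<ᵇ≡true u<x

  sumOver-insertions : (F : List ℕ → ℕ) →
                       sumOver (insertions x p) F ≡ F (x ∷ p) + sumOver (insertions x w) (λ q → F (u ∷ q))
  sumOver-insertions F = cong (F (x ∷ p) +_) (sumOver-map (u ∷_) (insertions x w) F)

  avoids-tail : (F : List ℕ → ℕ) (g : ℕ → ℕ) →
                sumOver (insertions x w) (λ q → avoids (u ∷ q) * F (u ∷ q) * g (descentsFrom u q)) ≡
                avoids p * g D * sumOver (insertions x w) (λ q → κ q * F (u ∷ q))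
  avoids-tail F g =
    trans (sumOver-congᴬ effs pointwise) (sumOver-*ˡ (insertions x w) (avoids p * g D) (λ q → κ q * F (u ∷ q)))
    where
    open ≡-Reasoning
    pointwise : ∀ {q} → Effect fresh u w q →
                avoids (u ∷ q) * F (u ∷ q) * g (descentsFrom u q) ≡ avoids p * g D * (κ q * F (u ∷ q))
    pointwise {q} eff = begin
      avoids (u ∷ q) * F (u ∷ q) * g (descentsFrom u q)
        ≡⟨ cong (λ a → a * F (u ∷ q) * g (descentsFrom u q)) (trans (cong (λ o → δ o 0) (occ132≡occ u q)) (avoids-split eff)) ⟩
      δ (occ fresh u w) 0 * κ q * F (u ∷ q) * g (descentsFrom u q)
        ≡⟨ regroup (δ (occ fresh u w) 0) (κ q) (F (u ∷ q)) (g (descentsFrom u q)) ⟩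
      δ (occ fresh u w) 0 * F (u ∷ q) * (κ q * g (descentsFrom u q))
        ≡⟨ cong (δ (occ fresh u w) 0 * F (u ∷ q) *_) (kept-weight eff g) ⟩
      δ (occ fresh u w) 0 * F (u ∷ q) * (κ q * g D)
        ≡⟨ cong (λ o → δ o 0 * F (u ∷ q) * (κ q * g D)) (sym (occ132≡occ u w)) ⟩
      avoids p * F (u ∷ q) * (κ q * g D)
        ≡⟨ regroup′ (avoids p) (F (u ∷ q)) (κ q) (g D) ⟩
      avoids p * g D * (κ q * F (u ∷ q)) ∎
      where
      regroup : ∀ a k f e → a * k * f * e ≡ a * f * (k * e)
      regroup = solve-∀
      regroup′ : ∀ a f k e → a * f * (k * e) ≡ a * e * (k * f)
      regroup′ = solve-∀

  once-tail : (g : ℕ → ℕ) →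
              sumOver (insertions x w) (λ q → once (u ∷ q) * g (descentsFrom u q)) ≡
              once p * g D * suc D + avoids p * g (suc D) * singleSlots p
  once-tail g = begin
    sumOver (insertions x w) (λ q → once (u ∷ q) * g (descentsFrom u q))
      ≡⟨ sumOver-congᴬ effs pointwise ⟩
    sumOver (insertions x w) (λ q → once p * g D * κ q + avoids p * g (suc D) * ρ q)
      ≡⟨ sumOver-+ (insertions x w) _ _ ⟩
    sumOver (insertions x w) (λ q → once p * g D * κ q) + sumOver (insertions x w) (λ q → avoids p * g (suc D) * ρ q)
      ≡⟨ cong₂ _+_ (trans (sumOver-*ˡ (insertions x w) (once p * g D) κ)
                          (cong (once p * g D *_) (kept-count fresh u w u<x w<x adj)))
                   (trans (sumOver-*ˡ (insertions x w) (avoids p * g (suc D)) ρ)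
                          (cong (avoids p * g (suc D) *_) (raisedByOne-count fresh u w u<x w<x adj))) ⟩
    once p * g D * suc D + avoids p * g (suc D) * singleSlots p ∎
    where
    open ≡-Reasoning
    pointwise : ∀ {q} → Effect fresh u w q →
                once (u ∷ q) * g (descentsFrom u q) ≡ once p * g D * κ q + avoids p * g (suc D) * ρ q
    pointwise {q} eff = begin
      once (u ∷ q) * g (descentsFrom u q)
        ≡⟨ cong (λ n → n * g (descentsFrom u q)) (trans (cong (λ o → δ o 1) (occ132≡occ u q)) (once-split eff)) ⟩
      (δ o 1 * κ q + δ o 0 * ρ q) * g (descentsFrom u q)
        ≡⟨ distribute (δ o 1) (κ q) (δ o 0) (ρ q) (g (descentsFrom u q)) ⟩
      δ o 1 * (κ q * g (descentsFrom u q)) + δ o 0 * (ρ q * g (descentsFrom u q))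
        ≡⟨ cong₂ (λ a b → δ o 1 * a + δ o 0 * b) (kept-weight eff g) (raisedByOne-weight eff g) ⟩
      δ o 1 * (κ q * g D) + δ o 0 * (ρ q * g (suc D))
        ≡⟨ cong (λ o′ → δ o′ 1 * (κ q * g D) + δ o′ 0 * (ρ q * g (suc D))) (sym (occ132≡occ u w)) ⟩
      once p * (κ q * g D) + avoids p * (ρ q * g (suc D))
        ≡⟨ cong₂ _+_ (swap (once p) (κ q) (g D)) (swap (avoids p) (ρ q) (g (suc D))) ⟩
      once p * g D * κ q + avoids p * g (suc D) * ρ q ∎
      where
      o = occ fresh u w
      distribute : ∀ a k b r e → (a * k + b * r) * e ≡ a * (k * e) + b * (r * e)
      distribute = solve-∀
      swap : ∀ a k e → a * (k * e) ≡ a * e * k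
      swap = solve-∀

  module _ (g : ℕ → ℕ) where

    private
      front : ∀ (W : List ℕ → ℕ) {a} → W (x ∷ p) ≡ a → W (x ∷ p) * g (descents (x ∷ p)) ≡ a * g (suc D)
      front _ W≡ = cong₂ (λ a d → a * g d) W≡ descents-front

      avoids-front : avoids (x ∷ p) ≡ avoids p
      avoids-front = cong (λ o → δ o 0) occ132-front

    avoids-insertions : sumOver (insertions x p) (λ q → avoids q * g (descents q)) ≡
                        avoids p * g (suc D) + avoids p * g D * suc D
    avoids-insertions = begin
      sumOver (insertions x p) (λ q → avoids q * g (descents q))
        ≡⟨ sumOver-insertions (λ q → avoids q * g (descents q)) ⟩
      avoids (x ∷ p) * g (descents (x ∷ p)) + sumOver (insertions x w) (λ q → avoids (u ∷ q) * g (descentsFrom u q))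
        ≡⟨ cong₂ _+_ (front avoids avoids-front)
                     (trans (sumOver-cong (insertions x w) (λ q → cong (_* g (descentsFrom u q)) (sym (*-identityʳ (avoids (u ∷ q))))))
                            (avoids-tail (λ _ → 1) g)) ⟩
      avoids p * g (suc D) + avoids p * g D * sumOver (insertions x w) (λ q → κ q * 1)
        ≡⟨ cong (λ n → avoids p * g (suc D) + avoids p * g D * n)
                (trans (sumOver-cong (insertions x w) (λ q → *-identityʳ (κ q))) (kept-count fresh u w u<x w<x adj)) ⟩
      avoids p * g (suc D) + avoids p * g D * suc D ∎
      where open ≡-Reasoning

    avoidsDown-insertions : sumOver (insertions x p) (λ q → avoidsDown q * g (descents q)) ≡
                            avoids p * g (suc D) + avoidsDown p * g D * D
    avoidsDown-insertions = begin
      sumOver (insertions x p) (λ q → avoidsDown q * g (descents q))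
        ≡⟨ sumOver-insertions (λ q → avoidsDown q * g (descents q)) ⟩
      avoidsDown (x ∷ p) * g (descents (x ∷ p)) + sumOver (insertions x w) (λ q → avoidsDown (u ∷ q) * g (descentsFrom u q))
        ≡⟨ cong₂ _+_ (front avoidsDown (trans (cong₂ (λ a b → a * 𝟙 b) avoids-front startsDown-front) (*-identityʳ (avoids p))))
                     (avoids-tail (λ q → 𝟙 (startsDown q)) g) ⟩
      avoids p * g (suc D) + avoids p * g D * sumOver (insertions x w) (λ q → κ q * 𝟙 (descentAfter u q))
        ≡⟨ cong (λ n → avoids p * g (suc D) + avoids p * g D * n) (kept-descentAfter fresh u w u<x w<x adj) ⟩
      avoids p * g (suc D) + avoids p * g D * (D * 𝟙 (startsDown p))
        ≡⟨ cong (avoids p * g (suc D) +_) (regroup (avoids p) (g D) D (𝟙 (startsDown p))) ⟩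
      avoids p * g (suc D) + avoidsDown p * g D * D ∎
      where
      open ≡-Reasoning
      regroup : ∀ a e d s → a * e * (d * s) ≡ a * s * e * d
      regroup = solve-∀

    avoidsSlots-insertions : sumOver (insertions x p) (λ q → avoidsSlots q * g (descents q)) ≡
                             avoidsSlots p * g (suc D) + (avoidsSlots p * g D * suc D + avoidsDown p * g D)
    avoidsSlots-insertions = begin
      sumOver (insertions x p) (λ q → avoidsSlots q * g (descents q))
        ≡⟨ sumOver-insertions (λ q → avoidsSlots q * g (descents q)) ⟩
      avoidsSlots (x ∷ p) * g (descents (x ∷ p)) + sumOver (insertions x w) (λ q → avoidsSlots (u ∷ q) * g (descentsFrom u q))
        ≡⟨ cong₂ _+_ (front avoidsSlots (cong₂ _*_ avoids-front singleSlots-front)) (avoids-tail singleSlots g) ⟩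
      avoidsSlots p * g (suc D) + avoids p * g D * sumOver (insertions x w) (λ q → κ q * singleSlotsFrom fresh u q)
        ≡⟨ cong (λ n → avoidsSlots p * g (suc D) + avoids p * g D * n) (kept-singleSlots fresh u w u<x w<x adj) ⟩
      avoidsSlots p * g (suc D) + avoids p * g D * (suc D * singleSlots p + 𝟙 (startsDown p) * 1)
        ≡⟨ cong (avoidsSlots p * g (suc D) +_) (regroup (avoids p) (g D) D (singleSlots p) (𝟙 (startsDown p))) ⟩
      avoidsSlots p * g (suc D) + (avoidsSlots p * g D * suc D + avoidsDown p * g D) ∎
      where
      open ≡-Reasoning
      regroup : ∀ a e d s t → a * e * (suc d * s + t * 1) ≡ a * s * e * suc d + a * t * e
      regroup = solve-∀

    once-insertions : sumOver (insertions x p) (λ q → once q * g (descents q)) ≡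
                      once p * g (suc D) + once p * g D * suc D + avoidsSlots p * g (suc D)
    once-insertions = begin
      sumOver (insertions x p) (λ q → once q * g (descents q))
        ≡⟨ sumOver-insertions (λ q → once q * g (descents q)) ⟩
      once (x ∷ p) * g (descents (x ∷ p)) + sumOver (insertions x w) (λ q → once (u ∷ q) * g (descentsFrom u q))
        ≡⟨ cong₂ _+_ (front once (cong (λ o → δ o 1) occ132-front)) (once-tail g) ⟩
      once p * g (suc D) + (once p * g D * suc D + avoids p * g (suc D) * singleSlots p)
        ≡⟨ regroup (once p * g (suc D)) (once p * g D * suc D) (avoids p) (g (suc D)) (singleSlots p) ⟩
      once p * g (suc D) + once p * g D * suc D + avoidsSlots p * g (suc D) ∎
      where
      open ≡-Reasoning
      regroup : ∀ a b c e s → a + (b + c * e * s) ≡ a + b + c * s * e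
      regroup = solve-∀

record Shape (n : ℕ) (p : List ℕ) : Set where
  field
    bounded  : All (_< suc n) p
    adjacent : AdjacentDistinct p
    length≡  : length p ≡ n

module _ {x : ℕ} where

  private
    ClosedAfter : ℕ → ℕ → List ℕ → Set
    ClosedAfter u l q = All (_< suc x) (u ∷ q) × AdjacentDistinct (u ∷ q) × length q ≡ suc l

    insertions-closedAfter : ∀ {u w} → u < x → All (_< x) w → AdjacentDistinct (u ∷ w) →
                             All (ClosedAfter u (length w)) (insertions x w)
    insertions-closedAfter {u} {[]}     u<x []           tt =
      (m<n⇒m<1+n u<x ∷ n<1+n x ∷ [] , (<⇒≢ u<x , tt) , refl) ∷ []
    insertions-closedAfter {u} {y ∷ ys} u<x (y<x ∷ ys<x) (u≢y , adj) =
      (m<n⇒m<1+n u<x ∷ n<1+n x ∷ m<n⇒m<1+n y<x ∷ All.map m<n⇒m<1+n ys<x , (<⇒≢ u<x , (≢-sym (<⇒≢ y<x) , adj)) , refl) ∷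
      map⁺ (All.map (λ { (bnd , adj′ , len) → (m<n⇒m<1+n u<x ∷ bnd) , (u≢y , adj′) , cong suc len })
                    (insertions-closedAfter y<x ys<x adj))

  insertions-shape : ∀ {n p} → x ≡ suc n → Shape n p → All (Shape (suc n)) (insertions x p)
  insertions-shape {n} {[]}    refl s = record { bounded = n<1+n x ∷ [] ; adjacent = tt ; length≡ = cong suc (Shape.length≡ s) } ∷ []
  insertions-shape {n} {u ∷ w} refl record { bounded = u<x ∷ w<x ; adjacent = adj ; length≡ = len } =
    record { bounded = n<1+n x ∷ m<n⇒m<1+n u<x ∷ All.map m<n⇒m<1+n w<x ; adjacent = ≢-sym (<⇒≢ u<x) , adj ; length≡ = cong suc len } ∷
    map⁺ (All.map (λ { (bnd , adj′ , len′) → record { bounded = bnd ; adjacent = adj′ ; length≡ = cong suc (trans len′ len) } })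
                  (insertions-closedAfter u<x w<x adj))

perms-shape : ∀ n → All (Shape n) (perms n)
perms-shape zero    = record { bounded = [] ; adjacent = tt ; length≡ = refl } ∷ []
perms-shape (suc n) = concat⁺ (map⁺ (All.map (insertions-shape refl) (perms-shape n)))

-- Distribution by descents

sumOver-perms-insertions : ∀ m (F G : List ℕ → ℕ) →
  (∀ {u w} → u < 2 + m → All (_< 2 + m) w → AdjacentDistinct (u ∷ w) → sumOver (insertions (2 + m) (u ∷ w)) F ≡ G (u ∷ w)) →
  sumOver (perms (2 + m)) F ≡ sumOver (perms (suc m)) G
sumOver-perms-insertions m F G step =
  trans (sumOver-concatMap (insertions (2 + m)) (perms (suc m)) F) (sumOver-congᴬ (perms-shape (suc m)) step′)
  where
  step′ : ∀ {p} → Shape (suc m) p → sumOver (insertions (2 + m) p) F ≡ G p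
  step′ {[]}    s = ⊥-elim (0≢1+n (Shape.length≡ s))
  step′ {u ∷ w} record { bounded = u<x ∷ w<x ; adjacent = adj } = step u<x w<x adj

profile : (List ℕ → ℕ) → ℕ → ℕ → ℕ
profile W n d = sumOver (perms n) (λ p → W p * δ (descents p) d)

profile-ascent-zero : ∀ (W : List ℕ → ℕ) n → sumOver (perms n) (λ p → W p * δ (suc (descents p)) 0) ≡ 0
profile-ascent-zero W n = sumOver-vanishing (perms n) (λ p → *-zeroʳ (W p))

profile-scaled : ∀ (W : List ℕ → ℕ) n d (k : ℕ → ℕ) →
                 sumOver (perms n) (λ p → W p * δ (descents p) d * k (descents p)) ≡ k d * profile W n d
profile-scaled W n d k =
  trans (sumOver-cong (perms n) pointwise) (sumOver-*ˡ (perms n) (k d) (λ p → W p * δ (descents p) d))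
  where
  pointwise : ∀ p → W p * δ (descents p) d * k (descents p) ≡ k d * (W p * δ (descents p) d)
  pointwise p = begin
    W p * δ (descents p) d * k (descents p)     ≡⟨ *-assoc (W p) _ _ ⟩
    W p * (δ (descents p) d * k (descents p))   ≡⟨ cong (W p *_) (δ-weight (descents p) d k) ⟩
    W p * (δ (descents p) d * k d)              ≡⟨ *-assoc (W p) _ _ ⟨
    W p * δ (descents p) d * k d                ≡⟨ *-comm _ (k d) ⟩
    k d * (W p * δ (descents p) d)              ∎
    where open ≡-Reasoning

module _ (m : ℕ) where

  private
    Ps = perms (suc m)

  profile-avoids-zero : profile avoids (2 + m) 0 ≡ profile avoids (suc m) 0
  profile-avoids-zero = begin
    profile avoids (2 + m) 0
      ≡⟨ sumOver-perms-insertions m _ _ (λ u<x w<x adj → InsertMaxInto.avoids-insertions u<x w<x adj (λ D → δ D 0)) ⟩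
    sumOver Ps (λ p → avoids p * δ (suc (descents p)) 0 + avoids p * δ (descents p) 0 * suc (descents p))
      ≡⟨ sumOver-+ Ps _ _ ⟩
    sumOver Ps (λ p → avoids p * δ (suc (descents p)) 0) + sumOver Ps (λ p → avoids p * δ (descents p) 0 * suc (descents p))
      ≡⟨ cong₂ _+_ (profile-ascent-zero avoids (suc m)) (profile-scaled avoids (suc m) 0 suc) ⟩
    1 * profile avoids (suc m) 0
      ≡⟨ *-identityˡ _ ⟩
    profile avoids (suc m) 0 ∎
    where open ≡-Reasoning

  profile-avoids-suc : ∀ d → profile avoids (2 + m) (suc d) ≡ profile avoids (suc m) d + suc (suc d) * profile avoids (suc m) (suc d)
  profile-avoids-suc d =
    trans (sumOver-perms-insertions m _ _ (λ u<x w<x adj → InsertMaxInto.avoids-insertions u<x w<x adj (λ D → δ D (suc d))))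
    (trans (sumOver-+ Ps _ _)
           (cong (profile avoids (suc m) d +_) (profile-scaled avoids (suc m) (suc d) suc)))

  profile-avoidsDown-zero : profile avoidsDown (2 + m) 0 ≡ 0
  profile-avoidsDown-zero =
    trans (sumOver-perms-insertions m _ _ (λ u<x w<x adj → InsertMaxInto.avoidsDown-insertions u<x w<x adj (λ D → δ D 0)))
    (trans (sumOver-+ Ps _ _)
           (cong₂ _+_ (profile-ascent-zero avoids (suc m)) (profile-scaled avoidsDown (suc m) 0 (λ D → D))))

  profile-avoidsDown-suc : ∀ d → profile avoidsDown (2 + m) (suc d) ≡
                                 profile avoids (suc m) d + suc d * profile avoidsDown (suc m) (suc d)
  profile-avoidsDown-suc d =
    trans (sumOver-perms-insertions m _ _ (λ u<x w<x adj → InsertMaxInto.avoidsDown-insertions u<x w<x adj (λ D → δ D (suc d))))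
    (trans (sumOver-+ Ps _ _)
           (cong (profile avoids (suc m) d +_) (profile-scaled avoidsDown (suc m) (suc d) (λ D → D))))

  profile-avoidsSlots : ∀ d → sumOver Ps (λ p → avoidsSlots p * δ (descents p) d * suc (descents p) + avoidsDown p * δ (descents p) d) ≡
                              suc d * profile avoidsSlots (suc m) d + profile avoidsDown (suc m) d
  profile-avoidsSlots d = trans (sumOver-+ Ps _ _) (cong (_+ profile avoidsDown (suc m) d) (profile-scaled avoidsSlots (suc m) d suc))

  profile-avoidsSlots-zero : profile avoidsSlots (2 + m) 0 ≡ 1 * profile avoidsSlots (suc m) 0 + profile avoidsDown (suc m) 0
  profile-avoidsSlots-zero =
    trans (sumOver-perms-insertions m _ _ (λ u<x w<x adj → InsertMaxInto.avoidsSlots-insertions u<x w<x adj (λ D → δ D 0)))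
    (trans (sumOver-+ Ps _ _)
           (cong₂ _+_ (profile-ascent-zero avoidsSlots (suc m)) (profile-avoidsSlots 0)))

  profile-avoidsSlots-suc : ∀ d → profile avoidsSlots (2 + m) (suc d) ≡
                                  profile avoidsSlots (suc m) d + (suc (suc d) * profile avoidsSlots (suc m) (suc d) + profile avoidsDown (suc m) (suc d))
  profile-avoidsSlots-suc d =
    trans (sumOver-perms-insertions m _ _ (λ u<x w<x adj → InsertMaxInto.avoidsSlots-insertions u<x w<x adj (λ D → δ D (suc d))))
    (trans (sumOver-+ Ps _ _)
           (cong (profile avoidsSlots (suc m) d +_) (profile-avoidsSlots (suc d))))

  profile-once-zero : profile once (2 + m) 0 ≡ 1 * profile once (suc m) 0
  profile-once-zero =
    trans (sumOver-perms-insertions m _ _ (λ u<x w<x adj → InsertMaxInto.once-insertions u<x w<x adj (λ D → δ D 0)))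
    (trans (sumOver-+ Ps _ _)
    (trans (cong₂ _+_ (trans (sumOver-+ Ps _ _) (cong₂ _+_ (profile-ascent-zero once (suc m)) (profile-scaled once (suc m) 0 suc)))
                      (profile-ascent-zero avoidsSlots (suc m)))
           (+-identityʳ _)))

  profile-once-suc : ∀ d → profile once (2 + m) (suc d) ≡
                           profile once (suc m) d + suc (suc d) * profile once (suc m) (suc d) + profile avoidsSlots (suc m) d
  profile-once-suc d =
    trans (sumOver-perms-insertions m _ _ (λ u<x w<x adj → InsertMaxInto.once-insertions u<x w<x adj (λ D → δ D (suc d))))
    (trans (sumOver-+ Ps _ _)
           (cong (_+ profile avoidsSlots (suc m) d)
                 (trans (sumOver-+ Ps _ _) (cong (profile once (suc m) d +_) (profile-scaled once (suc m) (suc d) suc)))))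

profile-avoids-stirling2 : ∀ n d → profile avoids (suc n) d ≡ stirling2 (suc n) (suc d)
profile-avoids-stirling2 zero    zero    = refl
profile-avoids-stirling2 zero    (suc d) = sym (trans (+-identityʳ _) (*-zeroʳ (suc (suc d))))
profile-avoids-stirling2 (suc n) zero    =
  trans (profile-avoids-zero n) (trans (profile-avoids-stirling2 n 0) (sym (trans (+-identityʳ _) (*-identityˡ _))))
profile-avoids-stirling2 (suc n) (suc d) =
  trans (profile-avoids-suc n d)
  (trans (cong₂ (λ a b → a + suc (suc d) * b) (profile-avoids-stirling2 n d) (profile-avoids-stirling2 n (suc d)))
         (+-comm (stirling2 (suc n) (suc d)) _))

-- Binomial transforms

-- W n d is the defect X (n + 1) (d + 1) − Σⱼ C(n,j) X j d; the hypotheses on W say that it obeys the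
-- recurrence of X with inhomogeneity Y (n + 1) (d + 2) − Σⱼ C(n,j) Y j (d + 1).
module BinomialTransform (a c : ℕ) (X Y W : ℕ → ℕ → ℕ)
  (X-zero : ∀ d → X 0 d ≡ 0)
  (X-rec₀ : ∀ j → X (suc j) 0 ≡ c * X j 0 + Y j 0)
  (X-rec  : ∀ j d → X (suc j) (suc d) ≡ a * X j d + (suc d + c) * X j (suc d) + Y j (suc d))
  (W-base : ∀ d → X 1 (suc d) ≡ W 0 d)
  (W-rec₀ : ∀ n → a * X (suc n) 0 + (1 + c) * W n 0 + Y (suc n) 1 ≡ binomialSum n (λ j → Y j 0) + W (suc n) 0)
  (W-rec  : ∀ n d → a * W n d + (2 + d + c) * W n (suc d) + Y (suc n) (2 + d) ≡
                    binomialSum n (λ j → Y j (suc d)) + W (suc n) (suc d))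
  where

  private
    linear : ∀ n p q (f g h : ℕ → ℕ) →
             binomialSum n (λ j → p * f j + q * g j + h j) ≡ p * binomialSum n f + q * binomialSum n g + binomialSum n h
    linear n p q f g h =
      trans (binomialSum-+ n (λ j → p * f j + q * g j) h)
            (cong (_+ binomialSum n h) (trans (binomialSum-+ n (λ j → p * f j) (λ j → q * g j))
                                              (cong₂ _+_ (binomialSum-*ˡ n p f) (binomialSum-*ˡ n q g))))

  X-binomial : ∀ n d → X (suc n) (suc d) ≡ binomialSum n (λ j → X j d) + W n d
  X-binomial zero    d = trans (W-base d) (cong (λ x → 1 * x + 0 + W 0 d) (sym (X-zero d)))
  X-binomial (suc n) zero = begin
    X (2 + n) 1
      ≡⟨ X-rec (suc n) 0 ⟩
    a * X (suc n) 0 + (1 + c) * X (suc n) 1 + Y (suc n) 1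
      ≡⟨ cong (λ x → a * X (suc n) 0 + (1 + c) * x + Y (suc n) 1) (X-binomial n 0) ⟩
    a * X (suc n) 0 + (1 + c) * (T₀ + W n 0) + Y (suc n) 1
      ≡⟨ regroup (a * X (suc n) 0) c T₀ (W n 0) (Y (suc n) 1) ⟩
    (a * X (suc n) 0 + (1 + c) * W n 0 + Y (suc n) 1) + (1 + c) * T₀
      ≡⟨ cong (_+ (1 + c) * T₀) (W-rec₀ n) ⟩
    (binomialSum n (λ j → Y j 0) + W (suc n) 0) + (1 + c) * T₀
      ≡⟨ regroup′ (binomialSum n (λ j → Y j 0)) (W (suc n) 0) c T₀ ⟩
    T₀ + (c * T₀ + 0 * T₀ + binomialSum n (λ j → Y j 0)) + W (suc n) 0
      ≡⟨ cong (λ t → T₀ + t + W (suc n) 0) (sym (linear n c 0 (λ j → X j 0) (λ j → X j 0) (λ j → Y j 0))) ⟩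
    T₀ + binomialSum n (λ j → c * X j 0 + 0 * X j 0 + Y j 0) + W (suc n) 0
      ≡⟨ cong (λ t → T₀ + t + W (suc n) 0) (binomialSum-cong n (λ j _ → sym (trans (X-rec₀ j) (cong (_+ Y j 0) (sym (+-identityʳ (c * X j 0))))))) ⟩
    T₀ + binomialSum n (λ j → X (suc j) 0) + W (suc n) 0
      ≡⟨ cong (_+ W (suc n) 0) (binomialSum-pascal n (λ j → X j 0)) ⟨
    binomialSum (suc n) (λ j → X j 0) + W (suc n) 0 ∎
    where
    open ≡-Reasoning
    T₀ = binomialSum n (λ j → X j 0)
    regroup : ∀ a c t v z → a + (1 + c) * (t + v) + z ≡ (a + (1 + c) * v + z) + (1 + c) * t
    regroup = solve-∀
    regroup′ : ∀ b v c t → (b + v) + (1 + c) * t ≡ t + (c * t + 0 * t + b) + v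
    regroup′ = solve-∀
  X-binomial (suc n) (suc d) = begin
    X (2 + n) (2 + d)
      ≡⟨ X-rec (suc n) (suc d) ⟩
    a * X (suc n) (suc d) + (2 + d + c) * X (suc n) (2 + d) + Y (suc n) (2 + d)
      ≡⟨ cong₂ (λ x x′ → a * x + (2 + d + c) * x′ + Y (suc n) (2 + d)) (X-binomial n d) (X-binomial n (suc d)) ⟩
    a * (Tₒ + W n d) + (2 + d + c) * (Tₛ + W n (suc d)) + Y (suc n) (2 + d)
      ≡⟨ regroup a (suc d + c) Tₒ (W n d) Tₛ (W n (suc d)) (Y (suc n) (2 + d)) ⟩
    (a * W n d + (2 + d + c) * W n (suc d) + Y (suc n) (2 + d)) + (a * Tₒ + (suc d + c) * Tₛ + Tₛ)
      ≡⟨ cong (_+ (a * Tₒ + (suc d + c) * Tₛ + Tₛ)) (W-rec n d) ⟩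
    (binomialSum n (λ j → Y j (suc d)) + W (suc n) (suc d)) + (a * Tₒ + (suc d + c) * Tₛ + Tₛ)
      ≡⟨ regroup′ (binomialSum n (λ j → Y j (suc d))) (W (suc n) (suc d)) a (suc d + c) Tₒ Tₛ ⟩
    Tₛ + (a * Tₒ + (suc d + c) * Tₛ + binomialSum n (λ j → Y j (suc d))) + W (suc n) (suc d)
      ≡⟨ cong (λ t → Tₛ + t + W (suc n) (suc d)) (sym (linear n a (suc d + c) (λ j → X j d) (λ j → X j (suc d)) (λ j → Y j (suc d)))) ⟩
    Tₛ + binomialSum n (λ j → a * X j d + (suc d + c) * X j (suc d) + Y j (suc d)) + W (suc n) (suc d)
      ≡⟨ cong (λ t → Tₛ + t + W (suc n) (suc d)) (binomialSum-cong n (λ j _ → sym (X-rec j d))) ⟩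
    Tₛ + binomialSum n (λ j → X (suc j) (suc d)) + W (suc n) (suc d)
      ≡⟨ cong (_+ W (suc n) (suc d)) (binomialSum-pascal n (λ j → X j (suc d))) ⟨
    binomialSum (suc n) (λ j → X j (suc d)) + W (suc n) (suc d) ∎
    where
    open ≡-Reasoning
    Tₒ = binomialSum n (λ j → X j d)
    Tₛ = binomialSum n (λ j → X j (suc d))
    regroup : ∀ a k t v t′ v′ z → a * (t + v) + suc k * (t′ + v′) + z ≡ (a * v + suc k * v′ + z) + (a * t + k * t′ + t′)
    regroup = solve-∀
    regroup′ : ∀ b v a k t t′ → (b + v) + (a * t + k * t′ + t′) ≡ t′ + (a * t + k * t′ + b) + v
    regroup′ = solve-∀

profile-avoidsDown-rec₀ : ∀ j → profile avoidsDown (suc j) 0 ≡ 0 * profile avoidsDown j 0 + stirling2 j 0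
profile-avoidsDown-rec₀ zero    = refl
profile-avoidsDown-rec₀ (suc m) = profile-avoidsDown-zero m

profile-avoidsDown-rec : ∀ j d → profile avoidsDown (suc j) (suc d) ≡
                                 0 * profile avoidsDown j d + (suc d + 0) * profile avoidsDown j (suc d) + stirling2 j (suc d)
profile-avoidsDown-rec zero    d = sym (trans (+-identityʳ _) (*-zeroʳ (suc d + 0)))
profile-avoidsDown-rec (suc m) d =
  trans (profile-avoidsDown-suc m d)
  (trans (cong (_+ suc d * profile avoidsDown (suc m) (suc d)) (profile-avoids-stirling2 m d))
  (trans (+-comm (stirling2 (suc m) (suc d)) _)
         (cong (λ k → k * profile avoidsDown (suc m) (suc d) + stirling2 (suc m) (suc d)) (sym (+-identityʳ (suc d))))))

profile-avoidsDown-binomial : ∀ n d → profile avoidsDown (suc n) (suc d) ≡ binomialSum n (λ j → profile avoidsDown j d) + 0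
profile-avoidsDown-binomial = X-binomial
  where
  open BinomialTransform 0 0 (profile avoidsDown) stirling2 (λ _ _ → 0)
         (λ _ → refl) profile-avoidsDown-rec₀ profile-avoidsDown-rec (λ _ → refl)
         (λ n → sym (trans (+-identityʳ _) (binomialSum-stirling2 n 0)))
         (λ n d → trans (cong (_+ stirling2 (suc n) (2 + d)) (*-zeroʳ (2 + d + 0)))
                        (sym (trans (+-identityʳ _) (binomialSum-stirling2 n (suc d)))))

profile-avoidsSlots-rec₀ : ∀ j → profile avoidsSlots (suc j) 0 ≡ 1 * profile avoidsSlots j 0 + profile avoidsDown j 0
profile-avoidsSlots-rec₀ zero    = refl
profile-avoidsSlots-rec₀ (suc m) = profile-avoidsSlots-zero m

profile-avoidsSlots-rec : ∀ j d → profile avoidsSlots (suc j) (suc d) ≡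
                                  1 * profile avoidsSlots j d + (suc d + 1) * profile avoidsSlots j (suc d) + profile avoidsDown j (suc d)
profile-avoidsSlots-rec zero    d = sym (trans (+-identityʳ _) (*-zeroʳ (suc d + 1)))
profile-avoidsSlots-rec (suc m) d =
  trans (profile-avoidsSlots-suc m d)
        (regroup (profile avoidsSlots (suc m) d) (profile avoidsSlots (suc m) (suc d)) (profile avoidsDown (suc m) (suc d)) d)
  where
  regroup : ∀ a b e d → a + (suc (suc d) * b + e) ≡ 1 * a + (suc d + 1) * b + e
  regroup = solve-∀

profile-avoidsSlots-at-zero : ∀ n → profile avoidsSlots (suc n) 0 ≡ stirling2 n 1
profile-avoidsSlots-at-zero zero    = refl
profile-avoidsSlots-at-zero (suc n) =
  trans (profile-avoidsSlots-rec₀ (suc n))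
        (cong₂ (λ a b → 1 * a + b) (profile-avoidsSlots-at-zero n) (profile-avoidsDown-rec₀ n))

profile-avoidsSlots-binomial : ∀ n d → profile avoidsSlots (suc n) (suc d) ≡
                                       binomialSum n (λ j → profile avoidsSlots j d) + stirling2 n (2 + d)
profile-avoidsSlots-binomial = X-binomial
  where
  W-rec₀ : ∀ n → 1 * profile avoidsSlots (suc n) 0 + 2 * stirling2 n 2 + profile avoidsDown (suc n) 1 ≡
                 binomialSum n (λ j → profile avoidsDown j 0) + stirling2 (suc n) 2
  W-rec₀ n = trans (cong₂ (λ a e → 1 * a + 2 * stirling2 n 2 + e) (profile-avoidsSlots-at-zero n) (profile-avoidsDown-binomial n 0))
                   (regroup (stirling2 n 1) (stirling2 n 2) _)
    where
    regroup : ∀ s₁ s₂ b → 1 * s₁ + 2 * s₂ + (b + 0) ≡ b + (2 * s₂ + s₁)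
    regroup = solve-∀
  W-rec : ∀ n d → 1 * stirling2 n (2 + d) + (2 + d + 1) * stirling2 n (3 + d) + profile avoidsDown (suc n) (2 + d) ≡
                  binomialSum n (λ j → profile avoidsDown j (suc d)) + stirling2 (suc n) (3 + d)
  W-rec n d = trans (cong (1 * stirling2 n (2 + d) + (2 + d + 1) * stirling2 n (3 + d) +_) (profile-avoidsDown-binomial n (suc d)))
                    (regroup (stirling2 n (2 + d)) (stirling2 n (3 + d)) _ d)
    where
    regroup : ∀ s₂ s₃ b d → 1 * s₂ + (2 + d + 1) * s₃ + (b + 0) ≡ b + ((3 + d) * s₃ + s₂)
    regroup = solve-∀
  open BinomialTransform 1 1 (profile avoidsSlots) (profile avoidsDown) (λ n d → stirling2 n (2 + d))
         (λ _ → refl) profile-avoidsSlots-rec₀ profile-avoidsSlots-rec (λ _ → refl) W-rec₀ W-rec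

shiftDescents : (ℕ → ℕ → ℕ) → ℕ → ℕ → ℕ
shiftDescents X j zero    = 0
shiftDescents X j (suc d) = X j d

profile-once-rec₀ : ∀ j → profile once (suc j) 0 ≡ 1 * profile once j 0 + 0
profile-once-rec₀ zero    = refl
profile-once-rec₀ (suc m) = trans (profile-once-zero m) (sym (+-identityʳ _))

profile-once-rec : ∀ j d → profile once (suc j) (suc d) ≡
                           1 * profile once j d + (suc d + 1) * profile once j (suc d) + profile avoidsSlots j d
profile-once-rec zero    d = sym (trans (+-identityʳ _) (*-zeroʳ (suc d + 1)))
profile-once-rec (suc m) d =
  trans (profile-once-suc m d)
        (regroup (profile once (suc m) d) (profile once (suc m) (suc d)) (profile avoidsSlots (suc m) d) d)
  where
  regroup : ∀ a b e d → a + suc (suc d) * b + e ≡ 1 * a + (suc d + 1) * b + e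
  regroup = solve-∀

profile-once-at-zero : ∀ n → profile once n 0 ≡ 0
profile-once-at-zero zero    = refl
profile-once-at-zero (suc n) = trans (profile-once-rec₀ n) (cong (λ v → 1 * v + 0) (profile-once-at-zero n))

profile-once-binomial : ∀ n d → profile once (suc n) (suc d) ≡
                                binomialSum n (λ j → profile once j d) + suc d * stirling2 n (2 + d)
profile-once-binomial = X-binomial
  where
  W-rec₀ : ∀ n → 1 * profile once (suc n) 0 + 2 * (1 * stirling2 n 2) + profile avoidsSlots (suc n) 0 ≡
                 binomialSum n (λ _ → 0) + 1 * stirling2 (suc n) 2
  W-rec₀ n = trans (cong₂ (λ v a → 1 * v + 2 * (1 * stirling2 n 2) + a) (profile-once-at-zero (suc n)) (profile-avoidsSlots-at-zero n))
                   (trans (regroup (stirling2 n 1) (stirling2 n 2)) (cong (_+ 1 * stirling2 (suc n) 2) (sym (binomialSum-zero n))))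
    where
    regroup : ∀ s₁ s₂ → 1 * 0 + 2 * (1 * s₂) + s₁ ≡ 0 + 1 * (2 * s₂ + s₁)
    regroup = solve-∀
  W-rec : ∀ n d → 1 * (suc d * stirling2 n (2 + d)) + (2 + d + 1) * ((2 + d) * stirling2 n (3 + d)) + profile avoidsSlots (suc n) (suc d) ≡
                  binomialSum n (λ j → profile avoidsSlots j d) + (2 + d) * stirling2 (suc n) (3 + d)
  W-rec n d = trans (cong (1 * (suc d * stirling2 n (2 + d)) + (2 + d + 1) * ((2 + d) * stirling2 n (3 + d)) +_) (profile-avoidsSlots-binomial n d))
                    (regroup (stirling2 n (2 + d)) (stirling2 n (3 + d)) (binomialSum n (λ j → profile avoidsSlots j d)) d)
    where
    regroup : ∀ s₂ s₃ b d → 1 * (suc d * s₂) + (2 + d + 1) * ((2 + d) * s₃) + (b + s₂) ≡ b + (2 + d) * ((3 + d) * s₃ + s₂)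
    regroup = solve-∀
  open BinomialTransform 1 1 (profile once) (shiftDescents (profile avoidsSlots)) (λ n d → suc d * stirling2 n (2 + d))
         (λ _ → refl) profile-once-rec₀ profile-once-rec (λ d → sym (*-zeroʳ (suc d))) W-rec₀ W-rec

v1≡sumOver-once : ∀ n → v1 n ≡ sumOver (perms n) once
v1≡sumOver-once n = count (perms n)
  where
  count : ∀ ps → length (filter (λ p → occ132 p ≟ 1) ps) ≡ sumOver ps once
  count []       = refl
  count (p ∷ ps) with occ132 p ≡ᵇ 1
  ... | true  = cong suc (count ps)
  ... | false = count ps

descentsFrom-≤-length : ∀ u w → descentsFrom u w ≤ length w
descentsFrom-≤-length u []      = z≤n
descentsFrom-≤-length u (v ∷ w) = +-mono-≤ (𝟙≤1 (v <ᵇ u)) (descentsFrom-≤-length v w)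
  where
  𝟙≤1 : ∀ b → 𝟙 b ≤ 1
  𝟙≤1 true  = s≤s z≤n
  𝟙≤1 false = z≤n

descents<length : ∀ p → descents p < suc (length p)
descents<length []      = z<s
descents<length (u ∷ w) = s≤s (m≤n⇒m≤1+n (descentsFrom-≤-length u w))

v1-profile : ∀ {n D} → n < D → v1 n ≡ sumBelow D (profile once n)
v1-profile {n} {D} n<D = begin
  v1 n                                                            ≡⟨ v1≡sumOver-once n ⟩
  sumOver (perms n) once                                          ≡⟨ sumOver-congᴬ (perms-shape n) spread ⟩
  sumOver (perms n) (λ p → sumBelow D (λ d → once p * δ (descents p) d)) ≡⟨ sumOver-sumBelow (perms n) D (λ p d → once p * δ (descents p) d) ⟩
  sumBelow D (profile once n)                                     ∎
  where
  open ≡-Reasoning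
  spread : ∀ {p} → Shape n p → once p ≡ sumBelow D (λ d → once p * δ (descents p) d)
  spread {p} s = sym (begin
    sumBelow D (λ d → once p * δ (descents p) d)   ≡⟨ sumBelow-*ˡ D (once p) (δ (descents p)) ⟩
    once p * sumBelow D (δ (descents p))           ≡⟨ cong (once p *_) (sumBelow-δ descents<D) ⟩
    once p * 1                                     ≡⟨ *-identityʳ (once p) ⟩
    once p                                         ∎)
    where
    descents<D : descents p < D
    descents<D = <-≤-trans (descents<length p) (subst (_< D) (sym (Shape.length≡ s)) n<D)

v1-binomial : ∀ m → v1 (2 + m) + bell (suc m) ≡ binomialSum (suc m) v1 + binomialSum m (λ i → bell (suc i))
v1-binomial m = begin
  v1 (2 + m) + bell (suc m)
    ≡⟨ cong₂ _+_ (v1-profile {2 + m} {3 + m} ≤-refl) (bell-stirling2 {m} {D} (n≤1+n (suc m))) ⟩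
  profile once (2 + m) 0 + sumBelow D (λ d → profile once (2 + m) (suc d)) + Bs
    ≡⟨ cong (λ v → v + sumBelow D (λ d → profile once (2 + m) (suc d)) + Bs) (profile-once-at-zero (2 + m)) ⟩
  sumBelow D (λ d → profile once (2 + m) (suc d)) + Bs
    ≡⟨ cong (_+ Bs) (trans (sumBelow-cong D (λ d _ → profile-once-binomial (suc m) d))
                         (sumBelow-+ D (λ d → binomialSum (suc m) (λ j → profile once j d)) (λ d → suc d * stirling2 (suc m) (2 + d)))) ⟩
  sumBelow D (λ d → binomialSum (suc m) (λ j → profile once j d)) + Ws + Bs
    ≡⟨ +-assoc (sumBelow D (λ d → binomialSum (suc m) (λ j → profile once j d))) Ws Bs ⟩
  sumBelow D (λ d → binomialSum (suc m) (λ j → profile once j d)) + (Ws + Bs)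
    ≡⟨ cong₂ _+_ onceSum stirlingSum ⟩
  binomialSum (suc m) v1 + binomialSum m (λ i → bell (suc i)) ∎
  where
  open ≡-Reasoning
  D  = 2 + m
  Ws = sumBelow D (λ d → suc d * stirling2 (suc m) (2 + d))
  Bs = sumBelow D (λ d → stirling2 (suc m) (suc d))
  onceSum : sumBelow D (λ d → binomialSum (suc m) (λ j → profile once j d)) ≡ binomialSum (suc m) v1
  onceSum = trans (sumBelow-binomialSum D (suc m) (profile once))
                  (binomialSum-cong (suc m) (λ j j≤ → sym (v1-profile (s≤s j≤))))
  stirlingSum : Ws + Bs ≡ binomialSum m (λ i → bell (suc i))
  stirlingSum =
    trans (sym (sumBelow-+ D (λ d → suc d * stirling2 (suc m) (2 + d)) (λ d → stirling2 (suc m) (suc d))))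
    (trans (sumBelow-cong D (λ d _ → sym (binomialSum-stirling2-suc m d)))
    (trans (sumBelow-binomialSum D m (λ i d → stirling2 (suc i) (suc d)))
           (binomialSum-cong m (λ i i≤m → sym (bell-stirling2 (s≤s (m≤n⇒m≤1+n i≤m)))))))

sumFromTo-sumBelow : ∀ m (f : ℕ → ℕ) → sumFromTo 1 m f ≡ sumBelow m (λ i → f (suc i))
sumFromTo-sumBelow m f = sum-map-applyUpTo m (λ i → f (1 + i)) (λ i → i)

binomialSum-interior : ∀ n (f : ℕ → ℕ) →
                       binomialSum (suc n) f ≡ 1 * f 0 + sumFromTo 1 n (λ k → (suc n C k) * f k) + f (suc n)
binomialSum-interior n f =
  trans (sumBelow-last (suc n) (λ k → (suc n C k) * f k))
        (cong₂ _+_ (cong (1 * f 0 +_) (sym (sumFromTo-sumBelow n (λ k → (suc n C k) * f k))))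
                   (trans (cong (_* f (suc n)) (nCn≡1 (suc n))) (*-identityˡ (f (suc n)))))

binomialSum-shifted : ∀ n (f : ℕ → ℕ) →
                      binomialSum n (λ i → f (suc i)) ≡ sumFromTo 1 n (λ k → (n C (k ∸ 1)) * f k) + f (suc n)
binomialSum-shifted n f =
  trans (sumBelow-last n (λ i → (n C i) * f (suc i)))
        (cong₂ _+_ (sym (sumFromTo-sumBelow n (λ k → (n C (k ∸ 1)) * f k)))
                   (trans (cong (_* f (suc n)) (nCn≡1 n)) (*-identityˡ (f (suc n)))))

v1-recurrence : ∀ m → v1 (2 + m) ≡ v1 (suc m) + sumFromTo 1 m (λ k → (suc m C k) * v1 k + (m C (k ∸ 1)) * bell k)
v1-recurrence m = +-cancelʳ-≡ (bell (suc m)) _ _ (begin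
  v1 (2 + m) + bell (suc m)
    ≡⟨ v1-binomial m ⟩
  binomialSum (suc m) v1 + binomialSum m (λ i → bell (suc i))
    ≡⟨ cong₂ _+_ (binomialSum-interior m v1) (binomialSum-shifted m bell) ⟩
  1 * 0 + Σ₁ + v1 (suc m) + (Σ₂ + bell (suc m))
    ≡⟨ regroup Σ₁ (v1 (suc m)) Σ₂ (bell (suc m)) ⟩
  v1 (suc m) + (Σ₁ + Σ₂) + bell (suc m)
    ≡⟨ cong (λ s → v1 (suc m) + s + bell (suc m)) (sym sumFromTo-+) ⟩
  v1 (suc m) + sumFromTo 1 m (λ k → (suc m C k) * v1 k + (m C (k ∸ 1)) * bell k) + bell (suc m) ∎)
  where
  open ≡-Reasoning
  Σ₁ = sumFromTo 1 m (λ k → (suc m C k) * v1 k)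
  Σ₂ = sumFromTo 1 m (λ k → (m C (k ∸ 1)) * bell k)
  regroup : ∀ a v b e → 1 * 0 + a + v + (b + e) ≡ v + (a + b) + e
  regroup = solve-∀
  sumFromTo-+ : sumFromTo 1 m (λ k → (suc m C k) * v1 k + (m C (k ∸ 1)) * bell k) ≡ Σ₁ + Σ₂
  sumFromTo-+ =
    trans (sumFromTo-sumBelow m (λ k → (suc m C k) * v1 k + (m C (k ∸ 1)) * bell k))
    (trans (sumBelow-+ m (λ i → (suc m C suc i) * v1 (suc i)) (λ i → (m C i) * bell (suc i)))
           (sym (cong₂ _+_ (sumFromTo-sumBelow m (λ k → (suc m C k) * v1 k)) (sumFromTo-sumBelow m (λ k → (m C (k ∸ 1)) * bell k)))))

theorem3 : (v1 0 ≡ 0) × ((n : ℕ) → v1 (suc n) ≡ v1 n + sumFromTo 1 (n ∸ 1) (λ k → (n C k) * v1 k + ((n ∸ 1) C (k ∸ 1)) * bell k))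
theorem3 = refl , λ { zero → refl ; (suc m) → v1-recurrence m }
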